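{- Let $F_{\underline{312}}(x,t)=\sum_{n\ge0}\sum_{\pi\in\mathbf S_n(132,\underline{123})}x^nt^{\mathrm{occ}_{312}(\pi)}$. Then $$F_{\underline{312}}(x,t)=\frac{1-x^2G+x^2-x^2t}{1-x-x^2G-x^2t},\qquad G=\frac{ -b-\sqrt{b^2-4a}}{2a},$$ with $a=x^2$ and $b=-1+x-x^2+x^2t$.
   Context: $\mathbf S_n(132,\underline{123})$ is the set of $\pi\in\mathbf S_n$ with no subsequence order-isomorphic to $132$ and no three consecutive entries order-isomorphic to $123$. $\mathrm{occ}_{312}(\pi)$ is the number of indices $i$ such that $\pi_i\pi_{i+1}\pi_{i+2}$ is order-isomorphic to $312$. -}

module Defs where

open import Data.Nat using (ℕ; zero; suc; _∸_; _<ᵇ_; _≡ᵇ_; _+_)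
open import Data.Bool using (Bool; true; false; _∧_; _∨_; not; if_then_else_)
open import Data.Bool.ListAction using (any)
open import Data.List using (List; []; _∷_; map; concatMap; filter; length; upTo; foldr)
open import Data.Integer using (ℤ; +_; -_) renaming (_+_ to _+ℤ_; _*_ to _*ℤ_)
open import Relation.Binary.PropositionalEquality using (_≡_)
open import Relation.Nullary.Decidable using (T?)
open import Data.Product using (Σ; _×_)

insertEverywhere : ℕ → List ℕ → List (List ℕ)
insertEverywhere x []       = (x ∷ []) ∷ []
insertEverywhere x (y ∷ ys) = (x ∷ y ∷ ys) ∷ map (y ∷_) (insertEverywhere x ys)

perms : ℕ → List (List ℕ)
perms zero    = [] ∷ []
perms (suc n) = concatMap (insertEverywhere (suc n)) (perms n)

has21above : ℕ → List ℕ → Bool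
has21above a []      = false
has21above a (b ∷ r) = ((a <ᵇ b) ∧ any (λ c → (a <ᵇ c) ∧ (c <ᵇ b)) r) ∨ has21above a r

contains132 : List ℕ → Bool
contains132 []      = false
contains132 (a ∷ r) = has21above a r ∨ contains132 r

containsCons123 : List ℕ → Bool
containsCons123 (a ∷ b ∷ c ∷ r) = ((a <ᵇ b) ∧ (b <ᵇ c)) ∨ containsCons123 (b ∷ c ∷ r)
containsCons123 _               = false

occ312 : List ℕ → ℕ
occ312 (a ∷ b ∷ c ∷ r) = (if (b <ᵇ c) ∧ (c <ᵇ a) then 1 else 0) + occ312 (b ∷ c ∷ r)
occ312 _               = 0

avoids : List ℕ → Bool
avoids π = not (contains132 π) ∧ not (containsCons123 π)

count : ℕ → ℕ → ℕ
count n k = length (filter (λ π → T? (avoids π ∧ (occ312 π ≡ᵇ k))) (perms n))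

-- Formal power series in x, t with integer coefficients:
-- s n k is the coefficient of x^n t^k.

Series : Set
Series = ℕ → ℕ → ℤ

sumℤ : List ℤ → ℤ
sumℤ = foldr _+ℤ_ (+ 0)

Σ≤ : ℕ → (ℕ → ℤ) → ℤ
Σ≤ n f = sumℤ (map f (upTo (suc n)))

_⊕_ : Series → Series → Series
(f ⊕ g) n k = f n k +ℤ g n k

⊖_ : Series → Series
(⊖ f) n k = - f n k

_⊝_ : Series → Series → Series
f ⊝ g = f ⊕ (⊖ g)

_⊛_ : Series → Series → Series
(f ⊛ g) n k = Σ≤ n (λ i → Σ≤ k (λ j → f i j *ℤ g (n ∸ i) (k ∸ j)))

infixl 6 _⊕_ _⊝_
infixl 7 _⊛_

mono : ℕ → ℕ → Series
mono a b n k = if (n ≡ᵇ a) ∧ (k ≡ᵇ b) then + 1 else + 0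

𝟙 X X² X²T : Series
𝟙   = mono 0 0
X   = mono 1 0
X²  = mono 2 0
X²T = mono 2 1

_≋_ : Series → Series → Set
f ≋ g = ∀ n k → f n k ≡ g n k

infix 4 _≋_

F : Series
F n k = + count n k

aS bS : Series
aS = X²
bS = ⊖ 𝟙 ⊕ X ⊝ X² ⊕ X²T

-- G is a root of a G^2 + b G + 1 = 0 (the root given by the minus sign
-- is the unique formal power series root; the other root has a pole at x = 0)
IsG : Series → Set
IsG G = aS ⊛ G ⊛ G ⊕ bS ⊛ G ⊕ 𝟙 ≋ (λ _ _ → + 0)

Num Den : Series → Series
Num G = 𝟙 ⊝ X² ⊛ G ⊕ X² ⊝ X²T
Den G = 𝟙 ⊝ X ⊝ X² ⊛ G ⊝ X²T

module Submission where

-- Series form a commutative ring ℤ[[t]][[x]] (PowerSeries,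
-- SeriesRing), in which an equation  h = c + x Ψ(h)  with Ψ respecting
-- agreement up to xⁿ has at most one solution (Agreement).  Hence the
-- quadratic has exactly one root, and for any f, v solving the functional
-- equations  f = equationF f v,  v = equationV f v  the root is f − v + t v
-- and f · Den G = Num G (ClosedForm).  Combinatorially, S(132, 123̲) is
-- generated by inserting a new maximum at the active sites of a permutation;
-- labelling a permutation by the shape of its start and its number of active
-- sites gives a generating tree (GeneratingTree, ActiveSiteTree) whose
-- first-passage decomposition at height 0 yields these equations for its
-- generating function F₀ and the series V₀ of its rises.  Finally the
-- insertion analysis (InsertMax, ActiveSites, Labels) shows that the
-- avoiders of length n are exactly the n-th level of the tree, so F = F₀
-- (Avoiders).

open import Level using (Level)
open import Algebra.Bundles using (CommutativeRing)
open import Defs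
open import Data.Product using (Σ; _×_; _,_)

-- Instantiating this twice gives the bivariate series ℤ[[t]][[x]].
module PowerSeries {c ℓ : Level} (R : CommutativeRing c ℓ) where

  open CommutativeRing R
  open import Data.Nat as ℕ using (ℕ; zero; suc; _∸_; _<_; _≤_; z≤n; s≤s)
  import Data.Nat.Properties as ℕ
  open import Function using (_∘_)
  open import Relation.Binary.PropositionalEquality as ≡ using (_≡_; _≢_)
  open import Relation.Binary.Reasoning.Setoid setoid
  open import Relation.Nullary.Negation using (contradiction)
  open import Algebra.Properties.CommutativeSemigroup +-commutativeSemigroup using (x∙yz≈y∙xz)

  ∑ : ℕ → (ℕ → Carrier) → Carrier
  ∑ zero    f = 0#
  ∑ (suc n) f = f 0 + ∑ n (f ∘ suc)

  ∑-cong : ∀ n {f g} → (∀ i → i < n → f i ≈ g i) → ∑ n f ≈ ∑ n g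
  ∑-cong zero    f≈g = refl
  ∑-cong (suc n) f≈g = +-cong (f≈g 0 (s≤s z≤n)) (∑-cong n (λ i i<n → f≈g (suc i) (s≤s i<n)))

  ∑-zero : ∀ n {f} → (∀ i → i < n → f i ≈ 0#) → ∑ n f ≈ 0#
  ∑-zero n f≈0 = trans (∑-cong n f≈0) (∑-zeros n)
    where
    ∑-zeros : ∀ n → ∑ n (λ _ → 0#) ≈ 0#
    ∑-zeros zero    = refl
    ∑-zeros (suc n) = trans (+-congˡ (∑-zeros n)) (+-identityˡ 0#)

  ∑-select : ∀ n a {f} → a < n → (∀ i → i ≢ a → f i ≈ 0#) → ∑ n f ≈ f a
  ∑-select (suc n) zero    {f} _ off =
    trans (+-congˡ (∑-zero n (λ i _ → off (suc i) (λ ())))) (+-identityʳ (f 0))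
  ∑-select (suc n) (suc a) {f} (s≤s a<n) off = begin
    f 0 + ∑ n (f ∘ suc) ≈⟨ +-congʳ (off 0 (λ ())) ⟩
    0# + ∑ n (f ∘ suc)  ≈⟨ +-identityˡ _ ⟩
    ∑ n (f ∘ suc)       ≈⟨ ∑-select n a a<n (λ i i≢a → off (suc i) (i≢a ∘ ℕ.suc-injective)) ⟩
    f (suc a)           ∎

  ∑-+ : ∀ n f g → ∑ n (λ i → f i + g i) ≈ ∑ n f + ∑ n g
  ∑-+ zero    f g = sym (+-identityˡ 0#)
  ∑-+ (suc n) f g = begin
    (f 0 + g 0) + ∑ n (λ i → f (suc i) + g (suc i)) ≈⟨ +-congˡ (∑-+ n (f ∘ suc) (g ∘ suc)) ⟩
    (f 0 + g 0) + (∑ n (f ∘ suc) + ∑ n (g ∘ suc))   ≈⟨ +-assoc _ _ _ ⟩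
    f 0 + (g 0 + (∑ n (f ∘ suc) + ∑ n (g ∘ suc)))   ≈⟨ +-congˡ (x∙yz≈y∙xz _ _ _) ⟩
    f 0 + (∑ n (f ∘ suc) + (g 0 + ∑ n (g ∘ suc)))   ≈⟨ +-assoc _ _ _ ⟨
    (f 0 + ∑ n (f ∘ suc)) + (g 0 + ∑ n (g ∘ suc))   ∎

  ∑-*ˡ : ∀ n a f → a * ∑ n f ≈ ∑ n (λ i → a * f i)
  ∑-*ˡ zero    a f = zeroʳ a
  ∑-*ˡ (suc n) a f = trans (distribˡ a _ _) (+-congˡ (∑-*ˡ n a (f ∘ suc)))

  ∑-*ʳ : ∀ n a f → ∑ n f * a ≈ ∑ n (λ i → f i * a)
  ∑-*ʳ zero    a f = zeroˡ a
  ∑-*ʳ (suc n) a f = trans (distribʳ a _ _) (+-congˡ (∑-*ʳ n a (f ∘ suc)))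

  ∑-last : ∀ n f → ∑ (suc n) f ≈ ∑ n f + f n
  ∑-last zero    f = trans (+-identityʳ _) (sym (+-identityˡ _))
  ∑-last (suc n) f = trans (+-congˡ (∑-last n (f ∘ suc))) (sym (+-assoc _ _ _))

  ∑-length : ∀ {m n} f → m ≡ n → ∑ m f ≈ ∑ n f
  ∑-length f ≡.refl = refl

  ∑-reverse : ∀ n f → ∑ n f ≈ ∑ n (λ i → f (n ∸ suc i))
  ∑-reverse zero    f = refl
  ∑-reverse (suc n) f = begin
    f 0 + ∑ n (f ∘ suc)                         ≈⟨ +-comm _ _ ⟩
    ∑ n (f ∘ suc) + f 0                         ≈⟨ +-congʳ (∑-reverse n (f ∘ suc)) ⟩
    ∑ n (λ i → f (suc (n ∸ suc i))) + f 0        ≈⟨ +-congʳ (∑-cong n (λ i i<n →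
                                                      reflexive (≡.cong f (≡.sym (ℕ.+-∸-assoc 1 i<n))))) ⟩
    ∑ n (λ i → f (n ∸ i)) + f 0                  ≈⟨ +-congˡ (reflexive (≡.cong f (≡.sym (ℕ.n∸n≡0 n)))) ⟩
    ∑ n (λ i → f (n ∸ i)) + f (n ∸ n)            ≈⟨ ∑-last n (λ i → f (n ∸ i)) ⟨
    ∑ (suc n) (λ i → f (n ∸ i))                  ∎

  ∑-triangle : ∀ N (F : ℕ → ℕ → Carrier) →
               ∑ N (λ i → ∑ (suc i) (λ j → F j i)) ≈ ∑ N (λ j → ∑ (N ∸ j) (λ m → F j (j ℕ.+ m)))
  ∑-triangle zero    F = refl
  ∑-triangle (suc N) F = begin
    ∑ (suc N) (λ i → ∑ (suc i) (λ j → F j i))           ≈⟨ ∑-last N _ ⟩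
    ∑ N (λ i → ∑ (suc i) (λ j → F j i)) + ∑ (suc N) col ≈⟨ +-congʳ (∑-triangle N F) ⟩
    ∑ N rows + ∑ (suc N) col                             ≈⟨ +-congʳ (trans (sym (+-identityʳ _))
                                                             (+-congˡ (∑-length _ (≡.sym (ℕ.n∸n≡0 N))))) ⟩
    (∑ N rows + rows N) + ∑ (suc N) col                  ≈⟨ +-congʳ (∑-last N rows) ⟨
    ∑ (suc N) rows + ∑ (suc N) col                       ≈⟨ ∑-+ (suc N) rows col ⟨
    ∑ (suc N) (λ j → rows j + col j)                     ≈⟨ ∑-cong (suc N) (λ j j<1+N → extend j (ℕ.≤-pred j<1+N)) ⟩
    ∑ (suc N) (λ j → ∑ (suc N ∸ j) (λ m → F j (j ℕ.+ m))) ∎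
    where
    rows col : ℕ → Carrier
    rows j = ∑ (N ∸ j) (λ m → F j (j ℕ.+ m))
    col  j = F j N
    extend : ∀ j → j ≤ N → rows j + col j ≈ ∑ (suc N ∸ j) (λ m → F j (j ℕ.+ m))
    extend j j≤N = begin
      rows j + F j N                           ≈⟨ +-congˡ (reflexive (≡.cong (F j) (≡.sym (ℕ.m+[n∸m]≡n j≤N)))) ⟩
      rows j + F j (j ℕ.+ (N ∸ j))             ≈⟨ ∑-last (N ∸ j) (λ m → F j (j ℕ.+ m)) ⟨
      ∑ (suc (N ∸ j)) (λ m → F j (j ℕ.+ m))    ≈⟨ ∑-length _ (≡.sym (ℕ.+-∸-assoc 1 j≤N)) ⟩
      ∑ (suc N ∸ j) (λ m → F j (j ℕ.+ m))      ∎

  Ser : Set c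
  Ser = ℕ → Carrier

  infix  4 _≈ₚ_
  infixl 6 _+ₚ_
  infixl 7 _*ₚ_

  _≈ₚ_ : Ser → Ser → Set ℓ
  f ≈ₚ g = ∀ n → f n ≈ g n

  _+ₚ_ : Ser → Ser → Ser
  (f +ₚ g) n = f n + g n

  -ₚ_ : Ser → Ser
  (-ₚ f) n = - f n

  0ₚ 1ₚ : Ser
  0ₚ n = 0#
  1ₚ zero    = 1#
  1ₚ (suc n) = 0#

  _*ₚ_ : Ser → Ser → Ser
  (f *ₚ g) n = ∑ (suc n) (λ i → f i * g (n ∸ i))

  -- The ring laws of the Cauchy product: commutativity by reversing the
  -- sum, associativity by exchanging the order of summation.
  *ₚ-comm : ∀ f g → f *ₚ g ≈ₚ g *ₚ f
  *ₚ-comm f g n = begin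
    ∑ (suc n) (λ i → f i * g (n ∸ i))              ≈⟨ ∑-reverse (suc n) (λ i → f i * g (n ∸ i)) ⟩
    ∑ (suc n) (λ i → f (n ∸ i) * g (n ∸ (n ∸ i)))  ≈⟨ ∑-cong (suc n) swap ⟩
    ∑ (suc n) (λ i → g i * f (n ∸ i))              ∎
    where
    swap : ∀ i → i < suc n → f (n ∸ i) * g (n ∸ (n ∸ i)) ≈ g i * f (n ∸ i)
    swap i i<1+n = trans (*-comm _ _) (*-congʳ (reflexive (≡.cong g (ℕ.m∸[m∸n]≡n (ℕ.≤-pred i<1+n)))))

  *ₚ-cong : ∀ {f f′ g g′} → f ≈ₚ f′ → g ≈ₚ g′ → f *ₚ g ≈ₚ f′ *ₚ g′
  *ₚ-cong f≈f′ g≈g′ n = ∑-cong (suc n) (λ i _ → *-cong (f≈f′ i) (g≈g′ (n ∸ i)))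

  *ₚ-identityˡ : ∀ f → 1ₚ *ₚ f ≈ₚ f
  *ₚ-identityˡ f n = trans (∑-select (suc n) 0 (s≤s z≤n) off) (*-identityˡ (f n))
    where
    off : ∀ i → i ≢ 0 → 1ₚ i * f (n ∸ i) ≈ 0#
    off zero    0≢0 = contradiction ≡.refl 0≢0
    off (suc i) _   = zeroˡ _

  *ₚ-distribˡ : ∀ f g h → f *ₚ (g +ₚ h) ≈ₚ f *ₚ g +ₚ f *ₚ h
  *ₚ-distribˡ f g h n = trans (∑-cong (suc n) (λ i _ → distribˡ (f i) (g (n ∸ i)) (h (n ∸ i))))
                              (∑-+ (suc n) (λ i → f i * g (n ∸ i)) (λ i → f i * h (n ∸ i)))

  *ₚ-assoc : ∀ f g h → (f *ₚ g) *ₚ h ≈ₚ f *ₚ (g *ₚ h)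
  *ₚ-assoc f g h n = begin
    ∑ (suc n) (λ i → ∑ (suc i) (λ j → f j * g (i ∸ j)) * h (n ∸ i))
      ≈⟨ ∑-cong (suc n) (λ i _ → ∑-*ʳ (suc i) (h (n ∸ i)) (λ j → f j * g (i ∸ j))) ⟩
    ∑ (suc n) (λ i → ∑ (suc i) (λ j → f j * g (i ∸ j) * h (n ∸ i)))
      ≈⟨ ∑-triangle (suc n) (λ j i → f j * g (i ∸ j) * h (n ∸ i)) ⟩
    ∑ (suc n) (λ j → ∑ (suc n ∸ j) (λ m → f j * g (j ℕ.+ m ∸ j) * h (n ∸ (j ℕ.+ m))))
      ≈⟨ ∑-cong (suc n) (λ j j<1+n → inner j (ℕ.≤-pred j<1+n)) ⟩
    ∑ (suc n) (λ j → f j * ∑ (suc (n ∸ j)) (λ m → g m * h (n ∸ j ∸ m)))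
      ∎
    where
    inner : ∀ j → j ≤ n → ∑ (suc n ∸ j) (λ m → f j * g (j ℕ.+ m ∸ j) * h (n ∸ (j ℕ.+ m)))
                          ≈ f j * ∑ (suc (n ∸ j)) (λ m → g m * h (n ∸ j ∸ m))
    inner j j≤n = begin
      ∑ (suc n ∸ j) (λ m → f j * g (j ℕ.+ m ∸ j) * h (n ∸ (j ℕ.+ m)))
        ≈⟨ ∑-length _ (ℕ.+-∸-assoc 1 j≤n) ⟩
      ∑ (suc (n ∸ j)) (λ m → f j * g (j ℕ.+ m ∸ j) * h (n ∸ (j ℕ.+ m)))
        ≈⟨ ∑-cong (suc (n ∸ j)) (λ m _ → trans (*-assoc (f j) _ _)
             (*-congˡ (*-cong (reflexive (≡.cong g (ℕ.m+n∸m≡n j m)))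
                              (reflexive (≡.cong h (≡.sym (ℕ.∸-+-assoc n j m))))))) ⟩
      ∑ (suc (n ∸ j)) (λ m → f j * (g m * h (n ∸ j ∸ m)))
        ≈⟨ ∑-*ˡ (suc (n ∸ j)) (f j) (λ m → g m * h (n ∸ j ∸ m)) ⟨
      f j * ∑ (suc (n ∸ j)) (λ m → g m * h (n ∸ j ∸ m))
        ∎

  powerSeriesRing : CommutativeRing c ℓ
  powerSeriesRing = record
    { Carrier = Ser ; _≈_ = _≈ₚ_ ; _+_ = _+ₚ_ ; _*_ = _*ₚ_ ; -_ = -ₚ_ ; 0# = 0ₚ ; 1# = 1ₚ
    ; isCommutativeRing = record
      { isRing = record
        { +-isAbelianGroup = record
          { isGroup = record
            { isMonoid = record
              { isSemigroup = record
                { isMagma = record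
                  { isEquivalence = record
                    { refl = λ n → refl ; sym = λ p n → sym (p n) ; trans = λ p q n → trans (p n) (q n) }
                  ; ∙-cong = λ p q n → +-cong (p n) (q n) }
                ; assoc = λ f g h n → +-assoc (f n) (g n) (h n) }
              ; identity = (λ f n → +-identityˡ (f n)) , (λ f n → +-identityʳ (f n)) }
            ; inverse = (λ f n → -‿inverseˡ (f n)) , (λ f n → -‿inverseʳ (f n))
            ; ⁻¹-cong = λ p n → -‿cong (p n) }
          ; comm = λ f g n → +-comm (f n) (g n) }
        ; *-cong = *ₚ-cong
        ; *-assoc = *ₚ-assoc
        ; *-identity = *ₚ-identityˡ , λ f n → trans (*ₚ-comm f 1ₚ n) (*ₚ-identityˡ f n)
        ; distrib = *ₚ-distribˡ , λ f g h n → trans (*ₚ-comm (g +ₚ h) f n)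
                      (trans (*ₚ-distribˡ f g h n) (+-cong (*ₚ-comm f g n) (*ₚ-comm f h n)))
        }
      ; *-comm = *ₚ-comm
      }
    }

module SeriesRing where

  open import Data.Bool using (Bool; true; false; if_then_else_; _∧_)
  open import Data.Integer as ℤ using (ℤ; +_)
  import Data.Integer.Properties as ℤ
  open import Data.List using (map; applyUpTo)
  open import Data.Maybe using (Maybe; just; nothing)
  open import Data.Nat as ℕ using (ℕ; zero; suc; _∸_; _≤_; _<_; _≡ᵇ_; z≤n; s≤s)
  import Data.Nat.Properties as ℕ
  open import Data.Sum using (_⊎_; inj₁; inj₂)
  open import Function using (_∘_)
  open import Level using (0ℓ)
  open import Relation.Binary.PropositionalEquality as ≡ using (_≡_; _≢_)
  open import Relation.Nullary using (yes; no)
  open import Relation.Nullary.Decidable using (dec-true; dec-false)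
  import Algebra.Solver.Ring
  open import Algebra.Solver.Ring.AlmostCommutativeRing
    using (_-Raw-AlmostCommutative⟶_; fromCommutativeRing)

  -- Series n k is the coefficient of xⁿ tᵏ: a series in x whose
  -- coefficients are series in t.
  module Inner = PowerSeries ℤ.+-*-commutativeRing
  module Outer = PowerSeries Inner.powerSeriesRing

  Σ≤-as-∑ : ∀ n f → Σ≤ n f ≡ Inner.∑ (suc n) f
  Σ≤-as-∑ n f = sum-map-applyUpTo (λ i → i) (suc n)
    where
    sum-map-applyUpTo : ∀ g m → sumℤ (map f (applyUpTo g m)) ≡ Inner.∑ m (f ∘ g)
    sum-map-applyUpTo g zero    = ≡.refl
    sum-map-applyUpTo g (suc m) = ≡.cong (λ z → f (g 0) ℤ.+ z) (sum-map-applyUpTo (g ∘ suc) m)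

  ∑-at : ∀ m (H : ℕ → ℕ → ℤ) k → Outer.∑ m H k ≡ Inner.∑ m (λ i → H i k)
  ∑-at zero    H k = ≡.refl
  ∑-at (suc m) H k = ≡.cong (λ z → H 0 k ℤ.+ z) (∑-at m (H ∘ suc) k)

  ⊛-as-*ₚ : ∀ f g → f ⊛ g ≋ f Outer.*ₚ g
  ⊛-as-*ₚ f g n k = begin
    Σ≤ n (λ i → Σ≤ k (λ j → f i j ℤ.* g (n ∸ i) (k ∸ j)))
      ≡⟨ Σ≤-as-∑ n (λ i → Σ≤ k (λ j → f i j ℤ.* g (n ∸ i) (k ∸ j))) ⟩
    Inner.∑ (suc n) (λ i → Σ≤ k (λ j → f i j ℤ.* g (n ∸ i) (k ∸ j)))
      ≡⟨ Inner.∑-cong (suc n) (λ i _ → Σ≤-as-∑ k (λ j → f i j ℤ.* g (n ∸ i) (k ∸ j))) ⟩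
    Inner.∑ (suc n) (λ i → (f i Inner.*ₚ g (n ∸ i)) k)
      ≡⟨ ∑-at (suc n) (λ i → f i Inner.*ₚ g (n ∸ i)) k ⟨
    (f Outer.*ₚ g) n k
      ∎
    where open ≡.≡-Reasoning

  𝟘 : Series
  𝟘 _ _ = + 0

  𝟙≋1ₚ : 𝟙 ≋ Outer.1ₚ
  𝟙≋1ₚ zero    zero    = ≡.refl
  𝟙≋1ₚ zero    (suc k) = ≡.refl
  𝟙≋1ₚ (suc n) k       = ≡.refl

  module _ where
    private
      module O = CommutativeRing Outer.powerSeriesRing
    open import Relation.Binary.Reasoning.Setoid O.setoid

    ⊛-cong : ∀ {f f′ g g′} → f ≋ f′ → g ≋ g′ → f ⊛ g ≋ f′ ⊛ g′
    ⊛-cong {f} {f′} {g} {g′} f≋f′ g≋g′ = begin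
      f ⊛ g      ≈⟨ ⊛-as-*ₚ f g ⟩
      f O.* g    ≈⟨ O.*-cong f≋f′ g≋g′ ⟩
      f′ O.* g′  ≈⟨ ⊛-as-*ₚ f′ g′ ⟨
      f′ ⊛ g′    ∎

    ⊛-comm : ∀ f g → f ⊛ g ≋ g ⊛ f
    ⊛-comm f g = begin
      f ⊛ g    ≈⟨ ⊛-as-*ₚ f g ⟩
      f O.* g  ≈⟨ O.*-comm f g ⟩
      g O.* f  ≈⟨ ⊛-as-*ₚ g f ⟨
      g ⊛ f    ∎

    ⊛-assoc : ∀ f g h → (f ⊛ g) ⊛ h ≋ f ⊛ (g ⊛ h)
    ⊛-assoc f g h = begin
      (f ⊛ g) ⊛ h      ≈⟨ ⊛-as-*ₚ (f ⊛ g) h ⟩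
      (f ⊛ g) O.* h    ≈⟨ O.*-congʳ {h} (⊛-as-*ₚ f g) ⟩
      (f O.* g) O.* h  ≈⟨ O.*-assoc f g h ⟩
      f O.* (g O.* h)  ≈⟨ O.*-congˡ {f} (⊛-as-*ₚ g h) ⟨
      f O.* (g ⊛ h)    ≈⟨ ⊛-as-*ₚ f (g ⊛ h) ⟨
      f ⊛ (g ⊛ h)      ∎

    ⊛-identityˡ : ∀ f → 𝟙 ⊛ f ≋ f
    ⊛-identityˡ f = begin
      𝟙 ⊛ f          ≈⟨ ⊛-as-*ₚ 𝟙 f ⟩
      𝟙 O.* f        ≈⟨ O.*-congʳ {f} 𝟙≋1ₚ ⟩
      Outer.1ₚ O.* f ≈⟨ O.*-identityˡ f ⟩
      f              ∎

    ⊛-distribˡ : ∀ f g h → f ⊛ (g ⊕ h) ≋ f ⊛ g ⊕ f ⊛ h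
    ⊛-distribˡ f g h = begin
      f ⊛ (g ⊕ h)        ≈⟨ ⊛-as-*ₚ f (g ⊕ h) ⟩
      f O.* (g ⊕ h)      ≈⟨ O.distribˡ f g h ⟩
      f O.* g ⊕ f O.* h  ≈⟨ O.+-cong (⊛-as-*ₚ f g) (⊛-as-*ₚ f h) ⟨
      f ⊛ g ⊕ f ⊛ h      ∎

    seriesRing : CommutativeRing 0ℓ 0ℓ
    seriesRing = record
      { Carrier = Series ; _≈_ = _≋_ ; _+_ = _⊕_ ; _*_ = _⊛_ ; -_ = ⊖_ ; 0# = 𝟘 ; 1# = 𝟙
      ; isCommutativeRing = record
        { isRing = record
          { +-isAbelianGroup = O.+-isAbelianGroup
          ; *-cong = ⊛-cong
          ; *-assoc = ⊛-assoc
          ; *-identity = ⊛-identityˡ , λ f → O.trans (⊛-comm f 𝟙) (⊛-identityˡ f)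
          ; distrib = ⊛-distribˡ , λ f g h → O.trans (⊛-comm (g ⊕ h) f)
                        (O.trans (⊛-distribˡ f g h) (O.+-cong (⊛-comm f g) (⊛-comm f h)))
          }
        ; *-comm = ⊛-comm
        }
      }

  monomial : ℤ → ℕ → ℕ → Series
  monomial z a b n k = if (n ≡ᵇ a) ∧ (k ≡ᵇ b) then z else + 0

  T : Series
  T = mono 0 1

  monomial-at : ∀ z a b → monomial z a b a b ≡ z
  monomial-at z a b rewrite dec-true (a ℕ.≟ a) ≡.refl | dec-true (b ℕ.≟ b) ≡.refl = ≡.refl

  monomial-off : ∀ z a b i j → i ≢ a ⊎ j ≢ b → monomial z a b i j ≡ + 0
  monomial-off z a b i j (inj₁ i≢a) rewrite dec-false (i ℕ.≟ a) i≢a = ≡.refl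
  monomial-off z a b i j (inj₂ j≢b) rewrite dec-false (j ℕ.≟ b) j≢b with i ≡ᵇ a
  ... | true  = ≡.refl
  ... | false = ≡.refl

  module _ (z : ℤ) (a b : ℕ) (g : Series) (n k : ℕ) where
    private
      term : ℕ → ℕ → ℤ
      term i j = monomial z a b i j ℤ.* g (n ∸ i) (k ∸ j)

      term-off : ∀ i j → i ≢ a ⊎ j ≢ b → term i j ≡ + 0
      term-off i j ne = ≡.cong (ℤ._* g (n ∸ i) (k ∸ j)) (monomial-off z a b i j ne)

      row-off : ∀ i → i ≢ a → Σ≤ k (term i) ≡ + 0
      row-off i i≢a = ≡.trans (Σ≤-as-∑ k (term i))
                              (Inner.∑-zero (suc k) (λ j _ → term-off i j (inj₁ i≢a)))

    monomial-⊛ : a ≤ n → b ≤ k → (monomial z a b ⊛ g) n k ≡ z ℤ.* g (n ∸ a) (k ∸ b)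
    monomial-⊛ a≤n b≤k = begin
      Σ≤ n (λ i → Σ≤ k (term i))         ≡⟨ Σ≤-as-∑ n (λ i → Σ≤ k (term i)) ⟩
      Inner.∑ (suc n) (λ i → Σ≤ k (term i)) ≡⟨ Inner.∑-select (suc n) a (s≤s a≤n) row-off ⟩
      Σ≤ k (term a)                      ≡⟨ Σ≤-as-∑ k (term a) ⟩
      Inner.∑ (suc k) (term a)            ≡⟨ Inner.∑-select (suc k) b (s≤s b≤k) (λ j j≢b → term-off a j (inj₂ j≢b)) ⟩
      term a b                            ≡⟨ ≡.cong (ℤ._* g (n ∸ a) (k ∸ b)) (monomial-at z a b) ⟩
      z ℤ.* g (n ∸ a) (k ∸ b)             ∎
      where open ≡.≡-Reasoning

    monomial-⊛-below : n < a ⊎ k < b → (monomial z a b ⊛ g) n k ≡ + 0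
    monomial-⊛-below below = ≡.trans (Σ≤-as-∑ n (λ i → Σ≤ k (term i))) (Inner.∑-zero (suc n) (row-zero below))
      where
      row-zero : n < a ⊎ k < b → ∀ i → i < suc n → Σ≤ k (term i) ≡ + 0
      row-zero (inj₁ n<a) i i≤n = row-off i (λ { ≡.refl → ℕ.<-irrefl ≡.refl (ℕ.<-≤-trans n<a (ℕ.≤-pred i≤n)) })
      row-zero (inj₂ k<b) i _   = ≡.trans (Σ≤-as-∑ k (term i)) (Inner.∑-zero (suc k) (λ j j≤k →
        term-off i j (inj₂ (λ { ≡.refl → ℕ.<-irrefl ≡.refl (ℕ.<-≤-trans k<b (ℕ.≤-pred j≤k)) }))))

  constant : ℤ → Series
  constant z = monomial z 0 0

  module _ where
    private
      at-origin : ℕ → ℕ → Bool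
      at-origin n k = (n ≡ᵇ 0) ∧ (k ≡ᵇ 0)

      +-homo : ∀ a b → constant (a ℤ.+ b) ≋ constant a ⊕ constant b
      +-homo a b n k with at-origin n k
      ... | true  = ≡.refl
      ... | false = ≡.refl

      *-homo : ∀ a b → constant (a ℤ.* b) ≋ constant a ⊛ constant b
      *-homo a b n k = ≡.trans (lemma (at-origin n k)) (≡.sym (monomial-⊛ a 0 0 (constant b) n k z≤n z≤n))
        where
        lemma : ∀ c → (if c then a ℤ.* b else + 0) ≡ a ℤ.* (if c then b else + 0)
        lemma true  = ≡.refl
        lemma false = ≡.sym (ℤ.*-zeroʳ a)

      -‿homo : ∀ a → constant (ℤ.- a) ≋ ⊖ constant a
      -‿homo a n k with at-origin n k
      ... | true  = ≡.refl
      ... | false = ≡.refl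

      0-homo : constant (+ 0) ≋ 𝟘
      0-homo n k with at-origin n k
      ... | true  = ≡.refl
      ... | false = ≡.refl

    constant-homomorphism : ℤ.+-*-rawRing -Raw-AlmostCommutative⟶ fromCommutativeRing seriesRing
    constant-homomorphism = record
      { ⟦_⟧ = constant ; +-homo = +-homo ; *-homo = *-homo ; -‿homo = -‿homo
      ; 0-homo = 0-homo ; 1-homo = λ _ _ → ≡.refl }

    constant-≟ : ∀ a b → Maybe (constant a ≋ constant b)
    constant-≟ a b with a ℤ.≟ b
    ... | yes ≡.refl = just (λ _ _ → ≡.refl)
    ... | no  _      = nothing

  module SeriesSolver = Algebra.Solver.Ring ℤ.+-*-rawRing (fromCommutativeRing seriesRing)
                                            constant-homomorphism constant-≟

module Agreement where

  open SeriesRing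
  open import Data.Integer as ℤ using (+_)
  import Data.Integer.Properties as ℤ
  open import Data.Nat as ℕ using (ℕ; zero; suc; _∸_; _≤_; z≤n; s≤s)
  import Data.Nat.Properties as ℕ
  open import Data.Sum using (inj₁)
  open import Relation.Binary.PropositionalEquality as ≡ using (_≡_)

  X⊛-zero : ∀ f k → (X ⊛ f) 0 k ≡ + 0
  X⊛-zero f k = monomial-⊛-below (+ 1) 1 0 f 0 k (inj₁ (s≤s z≤n))

  X⊛-suc : ∀ f n k → (X ⊛ f) (suc n) k ≡ f n k
  X⊛-suc f n k = ≡.trans (monomial-⊛ (+ 1) 1 0 f (suc n) k (s≤s z≤n) z≤n) (ℤ.*-identityˡ (f n k))

  infix 4 _≈[≤_]_

  _≈[≤_]_ : Series → ℕ → Series → Set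
  f ≈[≤ n ] g = ∀ m → m ≤ n → ∀ k → f m k ≡ g m k

  ≈[≤]-refl : ∀ {n} f → f ≈[≤ n ] f
  ≈[≤]-refl f m _ k = ≡.refl

  ≈[≤]-⊕ : ∀ {n f f′ g g′} → f ≈[≤ n ] f′ → g ≈[≤ n ] g′ → f ⊕ g ≈[≤ n ] f′ ⊕ g′
  ≈[≤]-⊕ f≈f′ g≈g′ m m≤n k = ≡.cong₂ ℤ._+_ (f≈f′ m m≤n k) (g≈g′ m m≤n k)

  ≈[≤]-⊖ : ∀ {n f f′} → f ≈[≤ n ] f′ → ⊖ f ≈[≤ n ] ⊖ f′
  ≈[≤]-⊖ f≈f′ m m≤n k = ≡.cong ℤ.-_ (f≈f′ m m≤n k)

  -- The coefficient of xᵐ in a product only involves coefficients of x^{≤m}.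
  ≈[≤]-⊛ : ∀ {n f f′ g g′} → f ≈[≤ n ] f′ → g ≈[≤ n ] g′ → f ⊛ g ≈[≤ n ] f′ ⊛ g′
  ≈[≤]-⊛ {n} {f} {f′} {g} {g′} f≈f′ g≈g′ m m≤n k =
    Σ≤-cong m (λ i i≤m → Σ≤-cong k (λ j _ →
      ≡.cong₂ ℤ._*_ (f≈f′ i (ℕ.≤-trans i≤m m≤n) j) (g≈g′ (m ∸ i) (ℕ.≤-trans (ℕ.m∸n≤m m i) m≤n) (k ∸ j))))
    where
    Σ≤-cong : ∀ l {h h′} → (∀ i → i ≤ l → h i ≡ h′ i) → Σ≤ l h ≡ Σ≤ l h′
    Σ≤-cong l {h} {h′} h≡h′ = ≡.trans (Σ≤-as-∑ l h)
      (≡.trans (Inner.∑-cong (suc l) (λ i i<1+l → h≡h′ i (ℕ.≤-pred i<1+l))) (≡.sym (Σ≤-as-∑ l h′)))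

  ≈[≤]-X⊛ : ∀ {n f g} → f ≈[≤ n ] g → X ⊛ f ≈[≤ suc n ] X ⊛ g
  ≈[≤]-X⊛ {f = f} {g} f≈g zero    _         k = ≡.trans (X⊛-zero f k) (≡.sym (X⊛-zero g k))
  ≈[≤]-X⊛ {f = f} {g} f≈g (suc m) (s≤s m≤n) k =
    ≡.trans (X⊛-suc f m k) (≡.trans (f≈g m m≤n k) (≡.sym (X⊛-suc g m k)))

  ≈[≤0]-X⊛ : ∀ f g → X ⊛ f ≈[≤ 0 ] X ⊛ g
  ≈[≤0]-X⊛ f g zero z≤n k = ≡.trans (X⊛-zero f k) (≡.sym (X⊛-zero g k))

  module _ {I : Set} (D : I → Set) (c : I → Series) (Ψ : (I → Series) → I → Series)
           (Ψ-respects : ∀ n h h′ → (∀ i → D i → h i ≈[≤ n ] h′ i) → ∀ i → D i → Ψ h i ≈[≤ n ] Ψ h′ i)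
           where

    unique-solution : ∀ h h′ → (∀ i → D i → h i ≋ c i ⊕ X ⊛ Ψ h i) →
                               (∀ i → D i → h′ i ≋ c i ⊕ X ⊛ Ψ h′ i) →
                      ∀ i → D i → h i ≋ h′ i
    unique-solution h h′ h-solves h′-solves i i∈D n k = agree n i i∈D n ℕ.≤-refl k
      where
      from-equations : ∀ {n} i → D i → c i ⊕ X ⊛ Ψ h i ≈[≤ n ] c i ⊕ X ⊛ Ψ h′ i → h i ≈[≤ n ] h′ i
      from-equations i i∈D rhs m m≤n k =
        ≡.trans (h-solves i i∈D m k) (≡.trans (rhs m m≤n k) (≡.sym (h′-solves i i∈D m k)))

      agree : ∀ n i → D i → h i ≈[≤ n ] h′ i
      agree zero    i i∈D = from-equations i i∈D (≈[≤]-⊕ (≈[≤]-refl (c i)) (≈[≤0]-X⊛ (Ψ h i) (Ψ h′ i)))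
      agree (suc n) i i∈D = from-equations i i∈D
        (≈[≤]-⊕ (≈[≤]-refl (c i)) (≈[≤]-X⊛ (Ψ-respects n h h′ (agree n) i i∈D)))

module ClosedForm where

  open SeriesRing
  open Agreement
  open import Data.Bool using (true; false)
  open import Data.Integer as ℤ using (+_)
  import Data.Integer.Properties as ℤ
  open import Data.Nat as ℕ using (ℕ; zero; suc; z≤n; s≤s)
  open import Data.Sum using (inj₂)
  open import Data.Unit using (⊤; tt)
  open import Relation.Binary.PropositionalEquality as ≡ using (_≡_)

  private
    module S = CommutativeRing seriesRing
  open import Relation.Binary.Reasoning.Setoid S.setoid
  open import Algebra.Properties.Group S.+-group using (x∙y⁻¹≈ε⇒x≈y; x≈y⇒x∙y⁻¹≈ε)
  open SeriesSolver using (solve; _:=_; _:+_; _:-_; _:*_; :-_; con)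

  X²≋X⊛X : X² ≋ X ⊛ X
  X²≋X⊛X zero    k = ≡.sym (X⊛-zero X k)
  X²≋X⊛X (suc n) k = ≡.sym (X⊛-suc X n k)

  X²T≋T⊛X² : X²T ≋ T ⊛ (X ⊛ X)
  X²T≋T⊛X² n zero    = ≡.trans (no-t⁰ n) (≡.sym (monomial-⊛-below (+ 1) 0 1 (X ⊛ X) n 0 (inj₂ (s≤s z≤n))))
    where
    no-t⁰ : ∀ n → X²T n 0 ≡ + 0
    no-t⁰ n with n ℕ.≡ᵇ 2
    ... | true  = ≡.refl
    ... | false = ≡.refl
  X²T≋T⊛X² n (suc k) = ≡.trans (X²≋X⊛X n k)
    (≡.sym (≡.trans (monomial-⊛ (+ 1) 0 1 (X ⊛ X) n (suc k) z≤n (s≤s z≤n)) (ℤ.*-identityˡ _)))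

  quadratic : Series → Series
  quadratic g = X ⊛ X ⊛ g ⊛ g ⊕ (⊖ 𝟙 ⊕ X ⊝ X ⊛ X ⊕ T ⊛ (X ⊛ X)) ⊛ g ⊕ 𝟙

  IsG≋quadratic : ∀ g → aS ⊛ g ⊛ g ⊕ bS ⊛ g ⊕ 𝟙 ≋ quadratic g
  IsG≋quadratic g = S.+-congʳ (S.+-cong (S.*-congʳ {g} (S.*-congʳ {g} X²≋X⊛X))
                                        (S.*-congʳ {g} (S.+-cong (S.+-congˡ {⊖ 𝟙 ⊕ X} (S.-‿cong X²≋X⊛X)) X²T≋T⊛X²)))

  -- A root satisfies G = 1 + x Ψ(G), a recursion determining G coefficientwise.
  rootStep : Series → Series
  rootStep g = g ⊝ X ⊛ g ⊕ T ⊛ X ⊛ g ⊕ X ⊛ g ⊛ g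

  rootStep-respects : ∀ n {g g′} → g ≈[≤ n ] g′ → rootStep g ≈[≤ n ] rootStep g′
  rootStep-respects n g≈g′ =
    ≈[≤]-⊕ (≈[≤]-⊕ (≈[≤]-⊕ g≈g′ (≈[≤]-⊖ (≈[≤]-⊛ (≈[≤]-refl X) g≈g′))) (≈[≤]-⊛ (≈[≤]-refl (T ⊛ X)) g≈g′))
           (≈[≤]-⊛ (≈[≤]-⊛ (≈[≤]-refl X) g≈g′) g≈g′)

  root-recursion : ∀ g → IsG g → g ≋ 𝟙 ⊕ X ⊛ rootStep g
  root-recursion g isG = S.sym (begin
    𝟙 ⊕ X ⊛ rootStep g  ≈⟨ identity g X T ⟩
    g ⊕ quadratic g     ≈⟨ S.+-congˡ {g} (S.trans (S.sym (IsG≋quadratic g)) isG) ⟩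
    g ⊕ 𝟘               ≈⟨ S.+-identityʳ g ⟩
    g                   ∎)
    where
    identity : ∀ g x t → 𝟙 ⊕ x ⊛ (g ⊝ x ⊛ g ⊕ t ⊛ x ⊛ g ⊕ x ⊛ g ⊛ g)
                       ≋ g ⊕ (x ⊛ x ⊛ g ⊛ g ⊕ (⊖ 𝟙 ⊕ x ⊝ x ⊛ x ⊕ t ⊛ (x ⊛ x)) ⊛ g ⊕ 𝟙)
    identity = solve 3 (λ g x t →
      con (+ 1) :+ x :* (g :- x :* g :+ t :* x :* g :+ x :* g :* g)
      := g :+ (x :* x :* g :* g :+ (:- con (+ 1) :+ x :- x :* x :+ t :* (x :* x)) :* g :+ con (+ 1)))
      (λ _ _ → ≡.refl)

  root-unique : ∀ g g′ → IsG g → IsG g′ → g ≋ g′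
  root-unique g g′ isG isG′ = unique-solution (λ _ → ⊤) (λ _ → 𝟙) (λ h _ → rootStep (h tt))
    (λ n h h′ h≈h′ _ _ → rootStep-respects n (h≈h′ tt tt))
    (λ _ → g) (λ _ → g′) (λ _ _ → root-recursion g isG) (λ _ _ → root-recursion g′ isG′) tt tt

  -- The functional equations satisfied by the generating function f of
  -- S_n(132, 123̲) by length and occ₃₁₂, together with the generating
  -- function v of those permutations starting with an ascent.
  equationF equationV : Series → Series → Series
  equationF f v = 𝟙 ⊕ X ⊛ f ⊕ X ⊛ X ⊛ (f ⊝ v ⊝ 𝟙) ⊛ f ⊕ X ⊛ X ⊛ (v ⊕ 𝟙) ⊛ (𝟙 ⊕ T ⊛ (f ⊝ 𝟙))
  equationV f v = X ⊛ v ⊕ X ⊛ X ⊛ (f ⊝ v ⊝ 𝟙) ⊛ v ⊕ X ⊛ X ⊛ (v ⊕ 𝟙) ⊛ (𝟙 ⊕ T ⊛ v)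

  module _ (f v : Series) (f-eq : f ≋ equationF f v) (v-eq : v ≋ equationV f v) where

    -- The root, eliminated from the two equations: G = f − v + t v.
    root : Series
    root = f ⊝ v ⊕ T ⊛ v

    root-isG : IsG root
    root-isG = S.trans (IsG≋quadratic root) (begin
      quadratic root
        ≈⟨ identity f v X T ⟩
      ⊖ (f ⊝ equationF f v) ⊕ (𝟙 ⊝ T) ⊛ (v ⊝ equationV f v)
        ≈⟨ S.+-cong (S.-‿cong (x≈y⇒x∙y⁻¹≈ε f-eq)) (S.*-congˡ {𝟙 ⊝ T} (x≈y⇒x∙y⁻¹≈ε v-eq)) ⟩
      ⊖ 𝟘 ⊕ (𝟙 ⊝ T) ⊛ 𝟘
        ≈⟨ S.+-congˡ {⊖ 𝟘} (S.zeroʳ (𝟙 ⊝ T)) ⟩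
      ⊖ 𝟘 ⊕ 𝟘
        ≈⟨ S.-‿inverseˡ 𝟘 ⟩
      𝟘 ∎)
      where
      identity : ∀ f v x t →
        x ⊛ x ⊛ (f ⊝ v ⊕ t ⊛ v) ⊛ (f ⊝ v ⊕ t ⊛ v) ⊕ (⊖ 𝟙 ⊕ x ⊝ x ⊛ x ⊕ t ⊛ (x ⊛ x)) ⊛ (f ⊝ v ⊕ t ⊛ v) ⊕ 𝟙
        ≋ ⊖ (f ⊝ (𝟙 ⊕ x ⊛ f ⊕ x ⊛ x ⊛ (f ⊝ v ⊝ 𝟙) ⊛ f ⊕ x ⊛ x ⊛ (v ⊕ 𝟙) ⊛ (𝟙 ⊕ t ⊛ (f ⊝ 𝟙))))
          ⊕ (𝟙 ⊝ t) ⊛ (v ⊝ (x ⊛ v ⊕ x ⊛ x ⊛ (f ⊝ v ⊝ 𝟙) ⊛ v ⊕ x ⊛ x ⊛ (v ⊕ 𝟙) ⊛ (𝟙 ⊕ t ⊛ v)))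
      identity = solve 4 (λ f v x t →
        x :* x :* (f :- v :+ t :* v) :* (f :- v :+ t :* v)
          :+ (:- con (+ 1) :+ x :- x :* x :+ t :* (x :* x)) :* (f :- v :+ t :* v) :+ con (+ 1)
        := :- (f :- (con (+ 1) :+ x :* f :+ x :* x :* (f :- v :- con (+ 1)) :* f
                     :+ x :* x :* (v :+ con (+ 1)) :* (con (+ 1) :+ t :* (f :- con (+ 1)))))
           :+ (con (+ 1) :- t) :* (v :- (x :* v :+ x :* x :* (f :- v :- con (+ 1)) :* v
                                         :+ x :* x :* (v :+ con (+ 1)) :* (con (+ 1) :+ t :* v))))
        (λ _ _ → ≡.refl)

    root-formula : f ⊛ Den root ≋ Num root
    root-formula = begin
      f ⊛ Den root
        ≈⟨ S.*-congˡ {f} (S.+-cong (S.+-congˡ {𝟙 ⊝ X} (S.-‿cong (S.*-congʳ {root} X²≋X⊛X))) (S.-‿cong X²T≋T⊛X²)) ⟩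
      f ⊛ (𝟙 ⊝ X ⊝ X ⊛ X ⊛ root ⊝ T ⊛ (X ⊛ X))
        ≈⟨ x∙y⁻¹≈ε⇒x≈y _ _ (S.trans (identity f v X T) (x≈y⇒x∙y⁻¹≈ε f-eq)) ⟩
      𝟙 ⊝ X ⊛ X ⊛ root ⊕ X ⊛ X ⊝ T ⊛ (X ⊛ X)
        ≈⟨ S.+-cong (S.+-cong (S.+-congˡ {𝟙} (S.-‿cong (S.*-congʳ {root} X²≋X⊛X))) X²≋X⊛X) (S.-‿cong X²T≋T⊛X²) ⟨
      Num root ∎
      where
      identity : ∀ f v x t →
        f ⊛ (𝟙 ⊝ x ⊝ x ⊛ x ⊛ (f ⊝ v ⊕ t ⊛ v) ⊝ t ⊛ (x ⊛ x))
          ⊝ (𝟙 ⊝ x ⊛ x ⊛ (f ⊝ v ⊕ t ⊛ v) ⊕ x ⊛ x ⊝ t ⊛ (x ⊛ x))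
        ≋ f ⊝ (𝟙 ⊕ x ⊛ f ⊕ x ⊛ x ⊛ (f ⊝ v ⊝ 𝟙) ⊛ f ⊕ x ⊛ x ⊛ (v ⊕ 𝟙) ⊛ (𝟙 ⊕ t ⊛ (f ⊝ 𝟙)))
      identity = solve 4 (λ f v x t →
        f :* (con (+ 1) :- x :- x :* x :* (f :- v :+ t :* v) :- t :* (x :* x))
          :- (con (+ 1) :- x :* x :* (f :- v :+ t :* v) :+ x :* x :- t :* (x :* x))
        := f :- (con (+ 1) :+ x :* f :+ x :* x :* (f :- v :- con (+ 1)) :* f
                 :+ x :* x :* (v :+ con (+ 1)) :* (con (+ 1) :+ t :* (f :- con (+ 1)))))
        (λ _ _ → ≡.refl)

    closed-form : Σ Series IsG × ((G : Series) → IsG G → f ⊛ Den G ≋ Num G)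
    closed-form = (root , root-isG) , λ G isG → begin
      f ⊛ Den G    ≈⟨ S.*-congˡ {f} (Den-cong (root-unique G root isG root-isG)) ⟩
      f ⊛ Den root ≈⟨ root-formula ⟩
      Num root     ≈⟨ Num-cong (root-unique root G root-isG isG) ⟩
      Num G        ∎
      where
      Den-cong : ∀ {g g′} → g ≋ g′ → Den g ≋ Den g′
      Den-cong g≋g′ = S.+-congʳ {⊖ X²T} (S.+-congˡ {𝟙 ⊝ X} (S.-‿cong (S.*-congˡ {X²} g≋g′)))
      Num-cong : ∀ {g g′} → g ≋ g′ → Num g ≋ Num g′
      Num-cong g≋g′ = S.+-congʳ {⊖ X²T} (S.+-congʳ {X²} (S.+-congˡ {𝟙} (S.-‿cong (S.*-congˡ {X²} g≋g′))))

-- A rule  children : S → List (S × ℕ)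
-- lists the labels of the children of a node together with the weight
-- (power of t) carried by each edge.
module GeneratingTree where

  open SeriesRing
  open Agreement
  open import Data.Bool using (Bool; true; false; if_then_else_; _∧_; _∨_; not)
  open import Data.Bool.Properties as Bool using ()
  open import Data.Integer as ℤ using (+_)
  import Data.Integer.Properties as ℤ
  open import Data.List using (List; []; _∷_; _++_; map; concatMap; foldr; length; filterᵇ)
  open import Data.Nat.ListAction using (sum)
  import Data.List.Properties as List
  open import Data.List.Relation.Unary.All as All using (All; []; _∷_)
  open import Data.Nat as ℕ using (ℕ; zero; suc; _+_; _∸_; _≤_; _<_; _≡ᵇ_; z≤n)
  import Data.Nat.Properties as ℕ
  open import Data.Product using (_×_; _,_; proj₁; proj₂)
  open import Data.Sum using (inj₂)
  open import Function using (_∘_; mk⇔)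
  open import Relation.Binary.PropositionalEquality as ≡ using (_≡_)
  open import Relation.Nullary.Decidable using (does-⇔; dec-false)
  open import Relation.Nullary.Negation using (contradiction)
  open import Relation.Nullary using (yes; no)

  private
    module S = CommutativeRing seriesRing
    variable
      A B : Set

  countᵇ : (A → Bool) → List A → ℕ
  countᵇ p []       = 0
  countᵇ p (x ∷ xs) = if p x then suc (countᵇ p xs) else countᵇ p xs

  length-filterᵇ : ∀ (p : A → Bool) xs → length (filterᵇ p xs) ≡ countᵇ p xs
  length-filterᵇ p []       = ≡.refl
  length-filterᵇ p (x ∷ xs) with p x
  ... | true  = ≡.cong suc (length-filterᵇ p xs)
  ... | false = length-filterᵇ p xs

  countᵇ-filterᵇ : ∀ (p q : A → Bool) xs → countᵇ p (filterᵇ q xs) ≡ countᵇ (λ x → q x ∧ p x) xs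
  countᵇ-filterᵇ p q []       = ≡.refl
  countᵇ-filterᵇ p q (x ∷ xs) with q x
  ... | true  = ≡.cong (λ n → if p x then suc n else n) (countᵇ-filterᵇ p q xs)
  ... | false = countᵇ-filterᵇ p q xs

  countᵇ-++ : ∀ (p : A → Bool) xs ys → countᵇ p (xs ++ ys) ≡ countᵇ p xs + countᵇ p ys
  countᵇ-++ p []       ys = ≡.refl
  countᵇ-++ p (x ∷ xs) ys with p x
  ... | true  = ≡.cong suc (countᵇ-++ p xs ys)
  ... | false = countᵇ-++ p xs ys

  countᵇ-map : ∀ (p : B → Bool) (f : A → B) xs → countᵇ p (map f xs) ≡ countᵇ (p ∘ f) xs
  countᵇ-map p f []       = ≡.refl
  countᵇ-map p f (x ∷ xs) = ≡.cong (λ n → if p (f x) then suc n else n) (countᵇ-map p f xs)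

  countᵇ-cong : ∀ {p q : A → Bool} → (∀ x → p x ≡ q x) → ∀ xs → countᵇ p xs ≡ countᵇ q xs
  countᵇ-cong p≗q []       = ≡.refl
  countᵇ-cong {q = q} p≗q (x ∷ xs) rewrite p≗q x = ≡.cong (λ n → if q x then suc n else n) (countᵇ-cong p≗q xs)

  countᵇ-none : ∀ {p : A → Bool} {xs} → All (λ x → p x ≡ false) xs → countᵇ p xs ≡ 0
  countᵇ-none []              = ≡.refl
  countᵇ-none (px≡false ∷ ps) rewrite px≡false = countᵇ-none ps

  countᵇ-concatMap : ∀ (p : B → Bool) (f : A → List B) xs →
                     countᵇ p (concatMap f xs) ≡ sum (map (countᵇ p ∘ f) xs)
  countᵇ-concatMap p f []       = ≡.refl
  countᵇ-concatMap p f (x ∷ xs) = ≡.trans (countᵇ-++ p (f x) (concatMap f xs))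
                                          (≡.cong (λ n → countᵇ p (f x) + n) (countᵇ-concatMap p f xs))

  countᵇ-∨ : ∀ (p q : A → Bool) → (∀ x → p x ∧ q x ≡ false) →
             ∀ xs → countᵇ (λ x → p x ∨ q x) xs ≡ countᵇ p xs + countᵇ q xs
  countᵇ-∨ p q disjoint []       = ≡.refl
  countᵇ-∨ p q disjoint (x ∷ xs) with p x in px | q x in qx
  ... | true  | true  = contradiction (≡.trans (≡.sym (≡.cong₂ _∧_ px qx)) (disjoint x)) λ ()
  ... | true  | false = ≡.cong suc (countᵇ-∨ p q disjoint xs)
  ... | false | true  = ≡.trans (≡.cong suc (countᵇ-∨ p q disjoint xs)) (≡.sym (ℕ.+-suc _ _))
  ... | false | false = countᵇ-∨ p q disjoint xs

  𝟙[_] : Bool → Series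
  𝟙[ b ] = if b then 𝟙 else 𝟘

  𝟙[]-suc : ∀ b m k → 𝟙[ b ] (suc m) k ≡ + 0
  𝟙[]-suc true  m k = ≡.refl
  𝟙[]-suc false m k = ≡.refl

  weighted : {S : Set} → List (S × ℕ) → (S → Series) → Series
  weighted L f = foldr _⊕_ 𝟘 (map (λ cw → mono 0 (proj₂ cw) ⊛ f (proj₁ cw)) L)

  module _ {S : Set} where
    open import Relation.Binary.Reasoning.Setoid S.setoid
    open import Algebra.Properties.CommutativeSemigroup S.+-commutativeSemigroup using (interchange)

    weighted-⊕ : ∀ L (f g : S → Series) → weighted L (λ c → f c ⊕ g c) ≋ weighted L f ⊕ weighted L g
    weighted-⊕ []       f g = S.sym (S.+-identityʳ 𝟘)
    weighted-⊕ (cw ∷ L) f g = begin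
      m ⊛ (f c ⊕ g c) ⊕ weighted L (λ c → f c ⊕ g c)  ≈⟨ S.+-cong (S.distribˡ m (f c) (g c)) (weighted-⊕ L f g) ⟩
      (m ⊛ f c ⊕ m ⊛ g c) ⊕ (weighted L f ⊕ weighted L g)  ≈⟨ interchange (m ⊛ f c) (m ⊛ g c) (weighted L f) (weighted L g) ⟩
      (m ⊛ f c ⊕ weighted L f) ⊕ (m ⊛ g c ⊕ weighted L g)  ∎
      where m = mono 0 (proj₂ cw); c = proj₁ cw

    weighted-scale : ∀ L a (f : S → Series) → weighted L (λ c → a ⊛ f c) ≋ a ⊛ weighted L f
    weighted-scale []       a f = S.sym (S.zeroʳ a)
    weighted-scale (cw ∷ L) a f = begin
      m ⊛ (a ⊛ f c) ⊕ weighted L (λ c → a ⊛ f c)  ≈⟨ S.+-cong (x∙yz≈y∙xz m a (f c)) (weighted-scale L a f) ⟩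
      a ⊛ (m ⊛ f c) ⊕ a ⊛ weighted L f            ≈⟨ S.distribˡ a _ _ ⟨
      a ⊛ (m ⊛ f c ⊕ weighted L f)                 ∎
      where m = mono 0 (proj₂ cw); c = proj₁ cw
            open import Algebra.Properties.CommutativeSemigroup S.*-commutativeSemigroup using (x∙yz≈y∙xz)

    weighted-split : ∀ (p : S × ℕ → Bool) L f →
                     weighted L f ≋ weighted (filterᵇ p L) f ⊕ weighted (filterᵇ (not ∘ p) L) f
    weighted-split p []       f = S.sym (S.+-identityʳ 𝟘)
    weighted-split p (cw ∷ L) f with p cw
    ... | true  = S.trans (S.+-congˡ {m} (weighted-split p L f)) (S.sym (S.+-assoc m kept dropped))
      where m = mono 0 (proj₂ cw) ⊛ f (proj₁ cw)
            kept = weighted (filterᵇ p L) f; dropped = weighted (filterᵇ (not ∘ p) L) f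
    ... | false = S.trans (S.+-congˡ {m} (weighted-split p L f)) (x∙yz≈y∙xz m kept dropped)
      where m = mono 0 (proj₂ cw) ⊛ f (proj₁ cw)
            kept = weighted (filterᵇ p L) f; dropped = weighted (filterᵇ (not ∘ p) L) f
            open import Algebra.Properties.CommutativeSemigroup S.+-commutativeSemigroup using (x∙yz≈y∙xz)

    weighted-single : ∀ (c : S) f → weighted ((c , 0) ∷ []) f ≋ f c
    weighted-single c f = S.trans (S.+-identityʳ _) (S.*-identityˡ (f c))

    weighted-singleᵗ : ∀ (c : S) f → weighted ((c , 1) ∷ []) f ≋ T ⊛ f c
    weighted-singleᵗ c f = S.+-identityʳ _

    ≈[≤]-weighted : ∀ {n} L {f g : S → Series} → All (λ cw → f (proj₁ cw) ≈[≤ n ] g (proj₁ cw)) L →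
                    weighted L f ≈[≤ n ] weighted L g
    ≈[≤]-weighted []       []         = ≈[≤]-refl 𝟘
    ≈[≤]-weighted (cw ∷ L) (fc≈gc ∷ fL≈gL) =
      ≈[≤]-⊕ (≈[≤]-⊛ (≈[≤]-refl (mono 0 (proj₂ cw))) fc≈gc) (≈[≤]-weighted L fL≈gL)

  module Tree {S : Set} (children : S → List (S × ℕ)) where

    -- A node of the tree: its label and the total weight of the path to it.
    Node : Set
    Node = S × ℕ

    shift : ℕ → Node → Node
    shift w nd = proj₁ nd , proj₂ nd + w

    expand : Node → List Node
    expand nd = map (λ cw → proj₁ cw , proj₂ nd + proj₂ cw) (children (proj₁ nd))

    level : S → ℕ → List Node
    level s zero    = (s , 0) ∷ []
    level s (suc n) = concatMap expand (level s n)

    private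
      concatMap-concatMap : ∀ {A B C : Set} (f : B → List C) (g : A → List B) xs →
                            concatMap f (concatMap g xs) ≡ concatMap (concatMap f ∘ g) xs
      concatMap-concatMap f g []       = ≡.refl
      concatMap-concatMap f g (x ∷ xs) = ≡.trans (List.concatMap-++ f (g x) (concatMap g xs))
                                                 (≡.cong (concatMap f (g x) ++_) (concatMap-concatMap f g xs))

      expand-shift : ∀ w nd → expand (shift w nd) ≡ map (shift w) (expand nd)
      expand-shift w nd = ≡.trans (List.map-cong reassociate (children (proj₁ nd))) (List.map-∘ (children (proj₁ nd)))
        where
        reassociate : ∀ cw → (proj₁ cw , proj₂ nd + w + proj₂ cw) ≡ (proj₁ cw , proj₂ nd + proj₂ cw + w)
        reassociate cw = ≡.cong (proj₁ cw ,_) (xy∙z≈xz∙y (proj₂ nd) w (proj₂ cw))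
          where open import Algebra.Properties.CommutativeSemigroup ℕ.+-commutativeSemigroup using (xy∙z≈xz∙y)

    level-suc : ∀ s n → level s (suc n) ≡ concatMap (λ cw → map (shift (proj₂ cw)) (level (proj₁ cw) n)) (children s)
    level-suc s zero = begin
      expand (s , 0) ++ []                                 ≡⟨ List.++-identityʳ _ ⟩
      map (λ cw → proj₁ cw , 0 + proj₂ cw) (children s)    ≡⟨ List.concatMap-pure (map (λ cw → proj₁ cw , 0 + proj₂ cw) (children s)) ⟨
      concatMap (_∷ []) (map (λ cw → proj₁ cw , 0 + proj₂ cw) (children s))
                                                           ≡⟨ List.concatMap-map (_∷ []) (λ cw → proj₁ cw , 0 + proj₂ cw) (children s) ⟩
      concatMap (λ cw → map (shift (proj₂ cw)) ((proj₁ cw , 0) ∷ [])) (children s) ∎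
      where open ≡.≡-Reasoning
    level-suc s (suc n) = begin
      concatMap expand (level s (suc n))               ≡⟨ ≡.cong (concatMap expand) (level-suc s n) ⟩
      concatMap expand (concatMap below (children s))  ≡⟨ concatMap-concatMap expand below (children s) ⟩
      concatMap (concatMap expand ∘ below) (children s) ≡⟨ List.concatMap-cong grow (children s) ⟩
      concatMap (λ cw → map (shift (proj₂ cw)) (level (proj₁ cw) (suc n))) (children s) ∎
      where
      open ≡.≡-Reasoning
      below : Node → List Node
      below cw = map (shift (proj₂ cw)) (level (proj₁ cw) n)
      grow : ∀ cw → concatMap expand (below cw) ≡ map (shift (proj₂ cw)) (level (proj₁ cw) (suc n))
      grow cw = begin
        concatMap expand (map (shift w) L)        ≡⟨ List.concatMap-map expand (shift w) L ⟩
        concatMap (expand ∘ shift w) L            ≡⟨ List.concatMap-cong (expand-shift w) L ⟩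
        concatMap (map (shift w) ∘ expand) L      ≡⟨ List.map-concatMap (shift w) expand L ⟨
        map (shift w) (concatMap expand L)        ∎
        where w = proj₂ cw; L = level (proj₁ cw) n

    hasLabel&Weight : (S → Bool) → ℕ → Node → Bool
    hasLabel&Weight P k nd = P (proj₁ nd) ∧ (proj₂ nd ≡ᵇ k)

    gf : (S → Bool) → S → Series
    gf P s n k = + countᵇ (hasLabel&Weight P k) (level s n)

    private
      weight-shift : ∀ o w k → w ≤ k → (o + w ≡ᵇ k) ≡ (o ≡ᵇ k ∸ w)
      weight-shift o w k w≤k = does-⇔ (mk⇔ to from) (o + w ℕ.≟ k) (o ℕ.≟ k ∸ w)
        where
        to : o + w ≡ k → o ≡ k ∸ w
        to eq = ≡.trans (≡.sym (ℕ.m+n∸n≡m o w)) (≡.cong (_∸ w) eq)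
        from : o ≡ k ∸ w → o + w ≡ k
        from eq = ≡.trans (≡.cong (_+ w) eq) (ℕ.m∸n+n≡m w≤k)

      weight-too-large : ∀ o w k → k < w → (o + w ≡ᵇ k) ≡ false
      weight-too-large o w k k<w =
        dec-false (o + w ℕ.≟ k) (λ eq → ℕ.<⇒≱ k<w (≡.subst (w ≤_) eq (ℕ.m≤n+m w o)))

      count-shifted : ∀ P c w m k →
        + countᵇ (hasLabel&Weight P k) (map (shift w) (level c m)) ≡ (mono 0 w ⊛ gf P c) m k
      count-shifted P c w m k with w ℕ.≤? k
      ... | yes w≤k = begin
        + countᵇ (hasLabel&Weight P k) (map (shift w) (level c m))
          ≡⟨ ≡.cong +_ (countᵇ-map _ (shift w) (level c m)) ⟩
        + countᵇ (hasLabel&Weight P k ∘ shift w) (level c m)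
          ≡⟨ ≡.cong +_ (countᵇ-cong (λ nd → ≡.cong (P (proj₁ nd) ∧_) (weight-shift (proj₂ nd) w k w≤k)) (level c m)) ⟩
        gf P c m (k ∸ w)
          ≡⟨ ℤ.*-identityˡ _ ⟨
        + 1 ℤ.* gf P c m (k ∸ w)
          ≡⟨ monomial-⊛ (+ 1) 0 w (gf P c) m k z≤n w≤k ⟨
        (mono 0 w ⊛ gf P c) m k ∎
        where open ≡.≡-Reasoning
      ... | no w≰k = ≡.trans (≡.cong +_ (≡.trans (countᵇ-map _ (shift w) (level c m))
                                                  (countᵇ-none {p = hasLabel&Weight P k ∘ shift w} {xs = level c m}
                                                    (All.tabulate λ {nd} _ → too-heavy nd))))
                             (≡.sym (monomial-⊛-below (+ 1) 0 w (gf P c) m k (inj₂ (ℕ.≰⇒> w≰k))))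
        where
        too-heavy : ∀ nd → hasLabel&Weight P k (shift w nd) ≡ false
        too-heavy nd = ≡.trans (≡.cong (P (proj₁ nd) ∧_) (weight-too-large (proj₂ nd) w k (ℕ.≰⇒> w≰k)))
                               (Bool.∧-zeroʳ (P (proj₁ nd)))

      count-children : ∀ P (L : List Node) m k →
        + sum (map (λ cw → countᵇ (hasLabel&Weight P k) (map (shift (proj₂ cw)) (level (proj₁ cw) m))) L)
        ≡ weighted L (gf P) m k
      count-children P []       m k = ≡.refl
      count-children P (cw ∷ L) m k = ≡.trans (ℤ.pos-+ (countBelow cw) (sum (map countBelow L)))
        (≡.cong₂ ℤ._+_ (count-shifted P (proj₁ cw) (proj₂ cw) m k) (count-children P L m k))
        where countBelow = λ cw → countᵇ (hasLabel&Weight P k) (map (shift (proj₂ cw)) (level (proj₁ cw) m))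

    gf-rec : ∀ P s → gf P s ≋ 𝟙[ P s ] ⊕ X ⊛ weighted (children s) (gf P)
    gf-rec P s zero k = ≡.sym (≡.trans (≡.cong (λ z → 𝟙[ P s ] 0 k ℤ.+ z) (X⊛-zero (weighted (children s) (gf P)) k))
                                       (≡.trans (ℤ.+-identityʳ _) (root-count (P s) k)))
      where
      root-count : ∀ b k → 𝟙[ b ] 0 k ≡ + countᵇ (λ nd → b ∧ (proj₂ nd ≡ᵇ k)) ((s , 0) ∷ [])
      root-count true  zero    = ≡.refl
      root-count true  (suc k) = ≡.refl
      root-count false k       = ≡.refl
    gf-rec P s (suc m) k = begin
      + countᵇ (hasLabel&Weight P k) (level s (suc m))
        ≡⟨ ≡.cong (λ L → + countᵇ (hasLabel&Weight P k) L) (level-suc s m) ⟩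
      + countᵇ (hasLabel&Weight P k) (concatMap (λ cw → map (shift (proj₂ cw)) (level (proj₁ cw) m)) (children s))
        ≡⟨ ≡.cong +_ (countᵇ-concatMap _ _ (children s)) ⟩
      + sum (map (λ cw → countᵇ (hasLabel&Weight P k) (map (shift (proj₂ cw)) (level (proj₁ cw) m))) (children s))
        ≡⟨ count-children P (children s) m k ⟩
      weighted (children s) (gf P) m k
        ≡⟨ X⊛-suc (weighted (children s) (gf P)) m k ⟨
      (X ⊛ weighted (children s) (gf P)) (suc m) k
        ≡⟨ ℤ.+-identityˡ _ ⟨
      + 0 ℤ.+ (X ⊛ weighted (children s) (gf P)) (suc m) k
        ≡⟨ ≡.cong (ℤ._+ (X ⊛ weighted (children s) (gf P)) (suc m) k) (𝟙[]-suc (P s) m k) ⟨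
      𝟙[ P s ] (suc m) k ℤ.+ (X ⊛ weighted (children s) (gf P)) (suc m) k ∎
      where open ≡.≡-Reasoning

    gf-cong : ∀ {P Q : S → Bool} → (∀ s → P s ≡ Q s) → ∀ s → gf P s ≋ gf Q s
    gf-cong P≗Q s n k = ≡.cong +_ (countᵇ-cong (λ nd → ≡.cong (_∧ (proj₂ nd ≡ᵇ k)) (P≗Q (proj₁ nd))) (level s n))

    gf-∨ : ∀ (P Q : S → Bool) → (∀ s → P s ∧ Q s ≡ false) →
           ∀ s → gf (λ s → P s ∨ Q s) s ≋ gf P s ⊕ gf Q s
    gf-∨ P Q disjoint s n k = ≡.trans
      (≡.cong +_ (≡.trans (countᵇ-cong distrib (level s n))
                          (countᵇ-∨ (hasLabel&Weight P k) (hasLabel&Weight Q k) disjoint′ (level s n))))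
      (ℤ.pos-+ (countᵇ (hasLabel&Weight P k) (level s n)) (countᵇ (hasLabel&Weight Q k) (level s n)))
      where
      distrib : ∀ nd → hasLabel&Weight (λ s → P s ∨ Q s) k nd ≡ hasLabel&Weight P k nd ∨ hasLabel&Weight Q k nd
      distrib nd = Bool.∧-distribʳ-∨ (proj₂ nd ≡ᵇ k) (P (proj₁ nd)) (Q (proj₁ nd))
      disjoint′ : ∀ nd → hasLabel&Weight P k nd ∧ hasLabel&Weight Q k nd ≡ false
      disjoint′ nd with proj₂ nd ≡ᵇ k
      ... | true  = ≡.trans (≡.cong₂ _∧_ (Bool.∧-identityʳ (P (proj₁ nd))) (Bool.∧-identityʳ (Q (proj₁ nd))))
                            (disjoint (proj₁ nd))
      ... | false = ≡.cong (_∧ (Q (proj₁ nd) ∧ false)) (Bool.∧-zeroʳ (P (proj₁ nd)))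

-- A permutation is labelled by its
-- shape and the number h of its active sites other than the front:
--   top  : π₁ is the maximum (then site 1 is active),
--   rise : π₁ < π₂,
--   fall : all other permutations.
-- Inserting the new maximum in front gives a top child of height h + 1,
-- with one new occurrence of 312 iff the parent is a rise; the insertions
-- into the other active sites give the children listed by insertions.
module ActiveSiteTree where

  open SeriesRing
  open Agreement
  open ClosedForm using (equationF; equationV)
  open GeneratingTree
  open import Data.Bool as Bool using (Bool; true; false; _∧_; _∨_; not)
  import Data.Bool.Properties as Bool
  open import Data.Integer using (+_)
  open import Data.List using (List; []; _∷_; map; concatMap; filterᵇ)
  import Data.List.Properties as List
  open import Data.List.Relation.Unary.All as All using (All; []; _∷_)
  import Data.List.Relation.Unary.All.Properties as All
  open import Data.Nat as ℕ using (ℕ; zero; suc)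
  open import Data.Nat.ListAction using (sum)
  open import Data.Product using (_×_; _,_; proj₁; proj₂)
  open import Data.Unit using (tt)
  open import Function using (_∘_)
  open import Relation.Binary.PropositionalEquality as ≡ using (_≡_)

  private
    module S = CommutativeRing seriesRing

  data Shape : Set where
    top fall rise : Shape

  Label : Set
  Label = Shape × ℕ

  shapeOf : Bool → Shape
  shapeOf true  = rise
  shapeOf false = fall

  descending : Shape → ℕ → List (Label × ℕ)
  descending sh zero    = []
  descending sh (suc m) = ((sh , m) , 0) ∷ descending sh m

  insertions : Shape → ℕ → List (Label × ℕ)
  insertions top  zero    = []
  insertions top  (suc h) = ((rise , h) , 0) ∷ descending fall h
  insertions fall h       = descending fall h
  insertions rise h       = descending rise h

  -- Inserting the maximum in front of a rise creates one 312.
  frontWeight : Shape → ℕ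
  frontWeight rise = 1
  frontWeight _    = 0

  rule : Label → List (Label × ℕ)
  rule (sh , h) = ((top , suc h) , frontWeight sh) ∷ insertions sh h

  module Full = Tree rule

  -- The empty permutation.
  root : Label
  root = fall , 0

  isRise : Shape → Bool
  isRise rise = true
  isRise _    = false

  everything startsRising isTop₀ : Label → Bool
  everything _ = true
  startsRising s = isRise (proj₁ s)
  isTop₀ (top , zero) = true
  isTop₀ _            = false

  F₀ V₀ : Series
  F₀ = Full.gf everything root
  V₀ = Full.gf startsRising root

  positive : Label → Bool
  positive (_ , zero)  = false
  positive (_ , suc _) = true

  rule⁺ : Label → List (Label × ℕ)
  rule⁺ s = filterᵇ (positive ∘ proj₁) (rule s)

  module Pos = Tree rule⁺

  raise : Label → Label
  raise s = proj₁ s , suc (proj₂ s)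

  raiseNode : Label × ℕ → Label × ℕ
  raiseNode nd = raise (proj₁ nd) , proj₂ nd

  private
    descending⁺ : ∀ sh m → filterᵇ (positive ∘ proj₁) (descending sh (suc m)) ≡ map raiseNode (descending sh m)
    descending⁺ sh zero    = ≡.refl
    descending⁺ sh (suc m) = ≡.cong (((sh , suc m) , 0) ∷_) (descending⁺ sh m)

    descending⁰ : ∀ sh m → filterᵇ (not ∘ positive ∘ proj₁) (descending sh (suc m)) ≡ ((sh , 0) , 0) ∷ []
    descending⁰ sh zero    = ≡.refl
    descending⁰ sh (suc m) = descending⁰ sh m

  rule⁺-raise : ∀ s → rule⁺ (raise s) ≡ map raiseNode (rule s)
  rule⁺-raise (top  , zero)  = ≡.refl
  rule⁺-raise (top  , suc h) = ≡.cong (λ L → ((top , suc (suc (suc h))) , 0) ∷ ((rise , suc h) , 0) ∷ L) (descending⁺ fall h)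
  rule⁺-raise (fall , h)     = ≡.cong (((top , suc (suc h)) , 0) ∷_) (descending⁺ fall h)
  rule⁺-raise (rise , h)     = ≡.cong (((top , suc (suc h)) , 1) ∷_) (descending⁺ rise h)

  level⁺-raise : ∀ s n → Pos.level (raise s) n ≡ map raiseNode (Full.level s n)
  level⁺-raise s zero    = ≡.refl
  level⁺-raise s (suc n) = begin
    concatMap Pos.expand (Pos.level (raise s) n)          ≡⟨ ≡.cong (concatMap Pos.expand) (level⁺-raise s n) ⟩
    concatMap Pos.expand (map raiseNode (Full.level s n))  ≡⟨ List.concatMap-map Pos.expand raiseNode (Full.level s n) ⟩
    concatMap (Pos.expand ∘ raiseNode) (Full.level s n)    ≡⟨ List.concatMap-cong expand-raise (Full.level s n) ⟩
    concatMap (map raiseNode ∘ Full.expand) (Full.level s n) ≡⟨ List.map-concatMap raiseNode Full.expand (Full.level s n) ⟨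
    map raiseNode (concatMap Full.expand (Full.level s n)) ∎
    where
    open ≡.≡-Reasoning
    expand-raise : ∀ nd → Pos.expand (raiseNode nd) ≡ map raiseNode (Full.expand nd)
    expand-raise nd = begin
      map (λ cw → proj₁ cw , proj₂ nd ℕ.+ proj₂ cw) (rule⁺ (raise (proj₁ nd)))
        ≡⟨ ≡.cong (map (λ cw → proj₁ cw , proj₂ nd ℕ.+ proj₂ cw)) (rule⁺-raise (proj₁ nd)) ⟩
      map (λ cw → proj₁ cw , proj₂ nd ℕ.+ proj₂ cw) (map raiseNode (rule (proj₁ nd)))
        ≡⟨ List.map-∘ (rule (proj₁ nd)) ⟨
      map (λ cw → raise (proj₁ cw) , proj₂ nd ℕ.+ proj₂ cw) (rule (proj₁ nd))
        ≡⟨ List.map-∘ (rule (proj₁ nd)) ⟩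
      map raiseNode (Full.expand nd) ∎

  gf⁺-raise : ∀ Q s → Pos.gf Q (raise s) ≋ Full.gf (Q ∘ raise) s
  gf⁺-raise Q s n k = ≡.cong +_ (≡.trans (≡.cong (countᵇ (Pos.hasLabel&Weight Q k)) (level⁺-raise s n))
                                         (countᵇ-map (Pos.hasLabel&Weight Q k) raiseNode (Full.level s n)))

  exitsToRise : Label → Bool
  exitsToRise (top  , suc zero)    = true
  exitsToRise (top  , _)           = false
  exitsToRise (fall , _)           = false
  exitsToRise (rise , _)           = true

  exit-child : ∀ sh h → filterᵇ (not ∘ positive ∘ proj₁) (rule (sh , suc h))
                        ≡ ((shapeOf (exitsToRise (sh , suc h)) , 0) , 0) ∷ []
  exit-child top  zero    = ≡.refl
  exit-child top  (suc h) = descending⁰ fall h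
  exit-child fall h       = descending⁰ fall h
  exit-child rise h       = descending⁰ rise h

  open import Relation.Binary.Reasoning.Setoid S.setoid
  open import Algebra.Properties.AbelianGroup S.+-abelianGroup using (xyx⁻¹≈y)

  -- A path from a label of positive height
  -- either stays at positive height, or reaches height 0 for the first time
  -- at the exit child of the last positive label, a fall or a rise.
  module FirstPassage (P : Label → Bool) where

    Positive : Label → Set
    Positive s = Bool.T (positive s)

    exitGF : Bool → Series
    exitGF r = Full.gf P (shapeOf r , 0)

    decomposition : Label → Series
    decomposition s = Pos.gf P s ⊕ exitGF false ⊛ (X ⊛ Pos.gf (not ∘ exitsToRise) s)
                                 ⊕ exitGF true  ⊛ (X ⊛ Pos.gf exitsToRise s)

    -- Both sides satisfy  h s ≋ 𝟙[ P s ] ⊕ X ⊛ step h s  at positive height.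
    step : (Label → Series) → Label → Series
    step h s = weighted (rule⁺ s) h ⊕ exitGF (exitsToRise s)

    -- The recursion is contracting on positive labels: children⁺ are positive.
    step-respects : ∀ n h h′ → (∀ s → Positive s → h s ≈[≤ n ] h′ s) →
                    ∀ s → Positive s → step h s ≈[≤ n ] step h′ s
    step-respects n h h′ h≈h′ s _ = ≈[≤]-⊕
      (≈[≤]-weighted (rule⁺ s) (All.map (λ {cw} → h≈h′ (proj₁ cw))
                                        (All.all-filter (Bool.T? ∘ positive ∘ proj₁) (rule s))))
      (≈[≤]-refl (exitGF (exitsToRise s)))

    -- The generating function satisfies the recursion: split off the exit child.
    gf-step : ∀ s → Positive s → Full.gf P s ≋ 𝟙[ P s ] ⊕ X ⊛ step (Full.gf P) s
    gf-step (sh , suc h) _ = S.trans (Full.gf-rec P s) (S.+-congˡ {𝟙[ P s ]} (S.*-congˡ {X}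
      (S.trans (weighted-split (positive ∘ proj₁) (rule s) (Full.gf P))
               (S.+-congˡ {weighted (rule⁺ s) (Full.gf P)} (S.trans (S.reflexive (≡.cong (λ L → weighted L (Full.gf P)) (exit-child sh h)))
                                   (weighted-single (shapeOf (exitsToRise s) , 0) (Full.gf P)))))))
      where s = sh , suc h

    private
      exits : ∀ r → exitGF false ⊛ 𝟙[ not r ] ⊕ exitGF true ⊛ 𝟙[ r ] ≋ exitGF r
      exits false = S.trans (S.+-cong (S.*-identityʳ (exitGF false)) (S.zeroʳ (exitGF true))) (S.+-identityʳ _)
      exits true  = S.trans (S.+-cong (S.zeroʳ (exitGF false)) (S.*-identityʳ (exitGF true))) (S.+-identityˡ _)

      weighted-decomposition : ∀ L → weighted L decomposition
        ≋ weighted L (Pos.gf P) ⊕ exitGF false ⊛ (X ⊛ weighted L (Pos.gf (not ∘ exitsToRise)))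
                                ⊕ exitGF true  ⊛ (X ⊛ weighted L (Pos.gf exitsToRise))
      weighted-decomposition L = begin
        weighted L decomposition
          ≈⟨ weighted-⊕ L (λ c → Pos.gf P c ⊕ exitGF false ⊛ (X ⊛ Pos.gf (not ∘ exitsToRise) c))
                          (λ c → exitGF true ⊛ (X ⊛ Pos.gf exitsToRise c)) ⟩
        weighted L (λ c → Pos.gf P c ⊕ exitGF false ⊛ (X ⊛ Pos.gf (not ∘ exitsToRise) c))
          ⊕ weighted L (λ c → exitGF true ⊛ (X ⊛ Pos.gf exitsToRise c))
          ≈⟨ S.+-cong (S.trans (weighted-⊕ L (Pos.gf P) (λ c → exitGF false ⊛ (X ⊛ Pos.gf (not ∘ exitsToRise) c)))
                               (S.+-congˡ {weighted L (Pos.gf P)} (exit-part false (not ∘ exitsToRise))))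
                      (exit-part true exitsToRise) ⟩
        weighted L (Pos.gf P) ⊕ exitGF false ⊛ (X ⊛ weighted L (Pos.gf (not ∘ exitsToRise)))
                              ⊕ exitGF true  ⊛ (X ⊛ weighted L (Pos.gf exitsToRise)) ∎
        where
        exit-part : ∀ r Q → weighted L (λ c → exitGF r ⊛ (X ⊛ Pos.gf Q c)) ≋ exitGF r ⊛ (X ⊛ weighted L (Pos.gf Q))
        exit-part r Q = S.trans (weighted-scale L (exitGF r) (λ c → X ⊛ Pos.gf Q c))
                                (S.*-congˡ {exitGF r} (weighted-scale L X (Pos.gf Q)))

    decomposition-step : ∀ s → Positive s → decomposition s ≋ 𝟙[ P s ] ⊕ X ⊛ step decomposition s
    decomposition-step s _ = begin
      decomposition s
        ≈⟨ S.+-cong (S.+-cong (Pos.gf-rec P s) (S.*-congˡ {nf} (S.*-congˡ {X} (Pos.gf-rec (not ∘ exitsToRise) s))))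
                    (S.*-congˡ {nr} (S.*-congˡ {X} (Pos.gf-rec exitsToRise s))) ⟩
      (𝟙[ P s ] ⊕ X ⊛ a) ⊕ nf ⊛ (X ⊛ (𝟙[ not r ] ⊕ X ⊛ b)) ⊕ nr ⊛ (X ⊛ (𝟙[ r ] ⊕ X ⊛ c))
        ≈⟨ regroup 𝟙[ P s ] X a nf 𝟙[ not r ] b nr 𝟙[ r ] c ⟩
      𝟙[ P s ] ⊕ X ⊛ ((a ⊕ nf ⊛ (X ⊛ b) ⊕ nr ⊛ (X ⊛ c)) ⊕ (nf ⊛ 𝟙[ not r ] ⊕ nr ⊛ 𝟙[ r ]))
        ≈⟨ S.+-congˡ {𝟙[ P s ]} (S.*-congˡ {X} (S.+-cong (S.sym (weighted-decomposition (rule⁺ s))) (exits r))) ⟩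
      𝟙[ P s ] ⊕ X ⊛ step decomposition s ∎
      where
      open SeriesSolver using (solve; _:=_; _:+_; _:*_)
      r = exitsToRise s
      nf = exitGF false
      nr = exitGF true
      a = weighted (rule⁺ s) (Pos.gf P)
      b = weighted (rule⁺ s) (Pos.gf (not ∘ exitsToRise))
      c = weighted (rule⁺ s) (Pos.gf exitsToRise)
      regroup : ∀ p x a nf kf b nr kr c →
        (p ⊕ x ⊛ a) ⊕ nf ⊛ (x ⊛ (kf ⊕ x ⊛ b)) ⊕ nr ⊛ (x ⊛ (kr ⊕ x ⊛ c))
        ≋ p ⊕ x ⊛ ((a ⊕ nf ⊛ (x ⊛ b) ⊕ nr ⊛ (x ⊛ c)) ⊕ (nf ⊛ kf ⊕ nr ⊛ kr))
      regroup = solve 9 (λ p x a nf kf b nr kr c →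
        (p :+ x :* a) :+ nf :* (x :* (kf :+ x :* b)) :+ nr :* (x :* (kr :+ x :* c))
        := p :+ x :* ((a :+ nf :* (x :* b) :+ nr :* (x :* c)) :+ (nf :* kf :+ nr :* kr)))
        (λ _ _ → ≡.refl)

    first-passage : ∀ s → Positive s → Full.gf P s ≋ decomposition s
    first-passage = unique-solution Positive (λ s → 𝟙[ P s ]) step step-respects
                                    (Full.gf P) decomposition gf-step decomposition-step

  gf-fall₀ : ∀ P → Full.gf P (fall , 0) ≋ 𝟙[ P (fall , 0) ] ⊕ X ⊛ Full.gf P (top , 1)
  gf-fall₀ P = S.trans (Full.gf-rec P (fall , 0))
    (S.+-congˡ {𝟙[ P (fall , 0) ]} (S.*-congˡ {X} (weighted-single (top , 1) (Full.gf P))))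

  gf-top₀ : ∀ P → Full.gf P (top , 0) ≋ 𝟙[ P (top , 0) ] ⊕ X ⊛ Full.gf P (top , 1)
  gf-top₀ P = S.trans (Full.gf-rec P (top , 0))
    (S.+-congˡ {𝟙[ P (top , 0) ]} (S.*-congˡ {X} (weighted-single (top , 1) (Full.gf P))))

  gf-rise₀ : ∀ P → Full.gf P (rise , 0) ≋ 𝟙[ P (rise , 0) ] ⊕ X ⊛ (T ⊛ Full.gf P (top , 1))
  gf-rise₀ P = S.trans (Full.gf-rec P (rise , 0))
    (S.+-congˡ {𝟙[ P (rise , 0) ]} (S.*-congˡ {X} (weighted-singleᵗ (top , 1) (Full.gf P))))

  -- No child is labelled (top, 0), so only the root of the tree at (top, 0) is.
  top₀-only-at-root : Full.gf isTop₀ (top , 0) ≋ 𝟙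
  top₀-only-at-root zero    zero    = ≡.refl
  top₀-only-at-root zero    (suc k) = ≡.refl
  top₀-only-at-root (suc n) k = ≡.cong +_ (≡.trans
    (countᵇ-concatMap (Full.hasLabel&Weight isTop₀ k) Full.expand (Full.level (top , 0) n))
    (sum-zero (Full.level (top , 0) n)))
    where
    descending-not-top₀ : ∀ sh → (∀ m → isTop₀ (sh , m) ≡ false) →
                          ∀ m → All (λ cw → isTop₀ (proj₁ cw) ≡ false) (descending sh m)
    descending-not-top₀ sh never zero    = []
    descending-not-top₀ sh never (suc m) = never m ∷ descending-not-top₀ sh never m

    insertions-not-top₀ : ∀ sh h → All (λ cw → isTop₀ (proj₁ cw) ≡ false) (insertions sh h)
    insertions-not-top₀ top  zero    = []
    insertions-not-top₀ top  (suc h) = ≡.refl ∷ descending-not-top₀ fall (λ _ → ≡.refl) h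
    insertions-not-top₀ fall h       = descending-not-top₀ fall (λ _ → ≡.refl) h
    insertions-not-top₀ rise h       = descending-not-top₀ rise (λ _ → ≡.refl) h

    none-in-expand : ∀ nd → countᵇ (Full.hasLabel&Weight isTop₀ k) (Full.expand nd) ≡ 0
    none-in-expand nd = ≡.trans (countᵇ-map (Full.hasLabel&Weight isTop₀ k) edge (rule (proj₁ nd)))
      (countᵇ-none {p = Full.hasLabel&Weight isTop₀ k ∘ edge} {xs = rule (proj₁ nd)}
        (All.map (λ {cw} not-top₀ → ≡.cong (_∧ (proj₂ (edge cw) ℕ.≡ᵇ k)) not-top₀)
                            (≡.refl ∷ insertions-not-top₀ (proj₁ (proj₁ nd)) (proj₂ (proj₁ nd)))))
      where
      edge : Label × ℕ → Label × ℕ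
      edge cw = proj₁ cw , proj₂ nd ℕ.+ proj₂ cw

    sum-zero : ∀ L → sum (map (countᵇ (Full.hasLabel&Weight isTop₀ k) ∘ Full.expand) L) ≡ 0
    sum-zero []       = ≡.refl
    sum-zero (nd ∷ L) = ≡.cong₂ ℕ._+_ (none-in-expand nd) (sum-zero L)

  private
    firstOrRising : Label → Bool
    firstOrRising s = isTop₀ s ∨ startsRising s

    exitsToRise-raise : ∀ s → exitsToRise (raise s) ≡ firstOrRising s
    exitsToRise-raise (top  , zero)  = ≡.refl
    exitsToRise-raise (top  , suc h) = ≡.refl
    exitsToRise-raise (fall , h)     = ≡.refl
    exitsToRise-raise (rise , h)     = ≡.refl

    top₀≋root : ∀ P → P (top , 0) ≡ P root → Full.gf P (top , 0) ≋ Full.gf P root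
    top₀≋root P same = S.trans (gf-top₀ P) (S.trans (S.reflexive (≡.cong (λ b → 𝟙[ b ] ⊕ X ⊛ Full.gf P (top , 1)) same))
                                                    (S.sym (gf-fall₀ P)))

    gf-firstOrRising : Full.gf firstOrRising (top , 0) ≋ 𝟙 ⊕ V₀
    gf-firstOrRising = S.trans (Full.gf-∨ isTop₀ startsRising disjoint (top , 0))
                               (S.+-cong top₀-only-at-root (top₀≋root startsRising ≡.refl))
      where
      disjoint : ∀ s → isTop₀ s ∧ startsRising s ≡ false
      disjoint (top  , zero)  = ≡.refl
      disjoint (top  , suc h) = ≡.refl
      disjoint (fall , h)     = ≡.refl
      disjoint (rise , h)     = ≡.refl

    gf-not-firstOrRising : Full.gf (not ∘ firstOrRising) (top , 0) ≋ F₀ ⊝ (𝟙 ⊕ V₀)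
    gf-not-firstOrRising = begin
      Full.gf (not ∘ firstOrRising) (top , 0)        ≈⟨ xyx⁻¹≈y q nq ⟨
      q ⊕ nq ⊝ q                                     ≈⟨ S.+-cong split (S.-‿cong (S.sym gf-firstOrRising)) ⟨
      Full.gf everything (top , 0) ⊝ (𝟙 ⊕ V₀)        ≈⟨ S.+-congʳ {⊖ (𝟙 ⊕ V₀)} (top₀≋root everything ≡.refl) ⟩
      F₀ ⊝ (𝟙 ⊕ V₀)                                  ∎
      where
      q = Full.gf firstOrRising (top , 0)
      nq = Full.gf (not ∘ firstOrRising) (top , 0)
      split : Full.gf everything (top , 0) ≋ q ⊕ nq
      split = S.trans (Full.gf-cong (λ s → ≡.sym (Bool.∨-inverseʳ (firstOrRising s))) (top , 0))
                      (Full.gf-∨ firstOrRising (not ∘ firstOrRising) (λ s → Bool.∧-inverseʳ (firstOrRising s)) (top , 0))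

  module ShapeCount (p : Shape → Bool) (top≡fall : p top ≡ p fall) where

    P : Label → Bool
    P = p ∘ proj₁

    Y Z : Series
    Y = Full.gf P root
    Z = Full.gf P (top , 1)

    Y≋ : Y ≋ 𝟙[ p fall ] ⊕ X ⊛ Z
    Y≋ = gf-fall₀ P

    -- First passage at (top, 1): stay positive (a copy of the tree at (top, 0)),
    -- exit to a fall (then continue as from the root), or exit to a rise.
    Z≋ : Z ≋ Y ⊕ Y ⊛ (X ⊛ (F₀ ⊝ (𝟙 ⊕ V₀))) ⊕ (𝟙[ p rise ] ⊕ X ⊛ (T ⊛ Z)) ⊛ (X ⊛ (𝟙 ⊕ V₀))
    Z≋ = S.trans (FirstPassage.first-passage P (top , 1) tt)
      (S.+-cong (S.+-cong (S.trans (gf⁺-raise P (top , 0)) (top₀≋root P top≡fall))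
                          (S.*-congˡ {Y} (S.*-congˡ {X} (S.trans (gf⁺-raise (not ∘ exitsToRise) (top , 0))
                            (S.trans (Full.gf-cong (λ s → ≡.cong not (exitsToRise-raise s)) (top , 0))
                                     gf-not-firstOrRising)))))
                (S.*-cong (gf-rise₀ P)
                          (S.*-congˡ {X} (S.trans (gf⁺-raise exitsToRise (top , 0))
                            (S.trans (Full.gf-cong exitsToRise-raise (top , 0)) gf-firstOrRising)))))

  private
    module Everything = ShapeCount (λ _ → true) ≡.refl
    module Rising = ShapeCount isRise ≡.refl

    open SeriesSolver using (solve; _:=_; _:+_; _:-_; _:*_; con)

    peel : ∀ {y c xz} → y ≋ c ⊕ xz → xz ≋ y ⊝ c
    peel {y} {c} {xz} y≋ = S.trans (S.sym (xyx⁻¹≈y c xz)) (S.+-congʳ {⊖ c} (S.sym y≋))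

  F₀-equation : F₀ ≋ equationF F₀ V₀
  F₀-equation = begin
    F₀                       ≈⟨ Everything.Y≋ ⟩
    𝟙 ⊕ X ⊛ Z                ≈⟨ S.+-congˡ {𝟙} (S.*-congˡ {X} Everything.Z≋) ⟩
    𝟙 ⊕ X ⊛ (F₀ ⊕ F₀ ⊛ (X ⊛ (F₀ ⊝ (𝟙 ⊕ V₀))) ⊕ (𝟙 ⊕ X ⊛ (T ⊛ Z)) ⊛ (X ⊛ (𝟙 ⊕ V₀)))
                             ≈⟨ expand F₀ V₀ X T Z ⟩
    𝟙 ⊕ X ⊛ F₀ ⊕ X ⊛ X ⊛ (F₀ ⊝ V₀ ⊝ 𝟙) ⊛ F₀ ⊕ X ⊛ X ⊛ (V₀ ⊕ 𝟙) ⊛ (𝟙 ⊕ T ⊛ (X ⊛ Z))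
                             ≈⟨ S.+-congˡ {𝟙 ⊕ X ⊛ F₀ ⊕ X ⊛ X ⊛ (F₀ ⊝ V₀ ⊝ 𝟙) ⊛ F₀}
                                  (S.*-congˡ {X ⊛ X ⊛ (V₀ ⊕ 𝟙)} (S.+-congˡ {𝟙} (S.*-congˡ {T} (peel {F₀} {𝟙} {X ⊛ Z} Everything.Y≋)))) ⟩
    equationF F₀ V₀          ∎
    where
    Z = Everything.Z
    expand : ∀ f v x t z →
      𝟙 ⊕ x ⊛ (f ⊕ f ⊛ (x ⊛ (f ⊝ (𝟙 ⊕ v))) ⊕ (𝟙 ⊕ x ⊛ (t ⊛ z)) ⊛ (x ⊛ (𝟙 ⊕ v)))
      ≋ 𝟙 ⊕ x ⊛ f ⊕ x ⊛ x ⊛ (f ⊝ v ⊝ 𝟙) ⊛ f ⊕ x ⊛ x ⊛ (v ⊕ 𝟙) ⊛ (𝟙 ⊕ t ⊛ (x ⊛ z))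
    expand = solve 5 (λ f v x t z →
      con (+ 1) :+ x :* (f :+ f :* (x :* (f :- (con (+ 1) :+ v))) :+ (con (+ 1) :+ x :* (t :* z)) :* (x :* (con (+ 1) :+ v)))
      := con (+ 1) :+ x :* f :+ x :* x :* (f :- v :- con (+ 1)) :* f :+ x :* x :* (v :+ con (+ 1)) :* (con (+ 1) :+ t :* (x :* z)))
      (λ _ _ → ≡.refl)

  V₀-equation : V₀ ≋ equationV F₀ V₀
  V₀-equation = begin
    V₀                       ≈⟨ S.trans Rising.Y≋ (S.+-identityˡ (X ⊛ Z)) ⟩
    X ⊛ Z                    ≈⟨ S.*-congˡ {X} Rising.Z≋ ⟩
    X ⊛ (V₀ ⊕ V₀ ⊛ (X ⊛ (F₀ ⊝ (𝟙 ⊕ V₀))) ⊕ (𝟙 ⊕ X ⊛ (T ⊛ Z)) ⊛ (X ⊛ (𝟙 ⊕ V₀)))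
                             ≈⟨ expand F₀ V₀ X T Z ⟩
    X ⊛ V₀ ⊕ X ⊛ X ⊛ (F₀ ⊝ V₀ ⊝ 𝟙) ⊛ V₀ ⊕ X ⊛ X ⊛ (V₀ ⊕ 𝟙) ⊛ (𝟙 ⊕ T ⊛ (X ⊛ Z))
                             ≈⟨ S.+-congˡ {X ⊛ V₀ ⊕ X ⊛ X ⊛ (F₀ ⊝ V₀ ⊝ 𝟙) ⊛ V₀}
                                  (S.*-congˡ {X ⊛ X ⊛ (V₀ ⊕ 𝟙)} (S.+-congˡ {𝟙} (S.*-congˡ {T}
                                    (S.sym (S.trans Rising.Y≋ (S.+-identityˡ (X ⊛ Z))))))) ⟩
    equationV F₀ V₀          ∎
    where
    Z = Rising.Z
    expand : ∀ f v x t z →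
      x ⊛ (v ⊕ v ⊛ (x ⊛ (f ⊝ (𝟙 ⊕ v))) ⊕ (𝟙 ⊕ x ⊛ (t ⊛ z)) ⊛ (x ⊛ (𝟙 ⊕ v)))
      ≋ x ⊛ v ⊕ x ⊛ x ⊛ (f ⊝ v ⊝ 𝟙) ⊛ v ⊕ x ⊛ x ⊛ (v ⊕ 𝟙) ⊛ (𝟙 ⊕ t ⊛ (x ⊛ z))
    expand = solve 5 (λ f v x t z →
      x :* (v :+ v :* (x :* (f :- (con (+ 1) :+ v))) :+ (con (+ 1) :+ x :* (t :* z)) :* (x :* (con (+ 1) :+ v)))
      := x :* v :+ x :* x :* (f :- v :- con (+ 1)) :* v :+ x :* x :* (v :+ con (+ 1)) :* (con (+ 1) :+ t :* (x :* z)))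
      (λ _ _ → ≡.refl)

module InsertMax where

  open import Data.Bool using (Bool; true; false; if_then_else_; _∧_; _∨_; not)
  import Data.Bool.Properties as Bool
  open import Data.Bool.ListAction using (any)
  open import Data.List using (List; []; _∷_; _++_; length)
  open import Data.List.Relation.Unary.All as All using (All; []; _∷_)
  import Data.List.Relation.Unary.All.Properties as All
  open import Data.Nat as ℕ using (ℕ; zero; suc; _+_; _≤_; _<_; _<ᵇ_)
  import Data.Nat.Properties as ℕ
  open import Relation.Binary.PropositionalEquality as ≡ using (_≡_)
  open import Relation.Nullary.Decidable using (dec-true; dec-false)
  open import Relation.Nullary.Negation using (contradiction)

  <ᵇ-true : ∀ {m n} → m < n → (m <ᵇ n) ≡ true
  <ᵇ-true {m} {n} = dec-true (m ℕ.<? n)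

  <ᵇ-false : ∀ {m n} → n ≤ m → (m <ᵇ n) ≡ false
  <ᵇ-false {m} {n} n≤m = dec-false (m ℕ.<? n) (ℕ.≤⇒≯ n≤m)

  <ᵇ-false⁻¹ : ∀ m n → (m <ᵇ n) ≡ false → n ≤ m
  <ᵇ-false⁻¹ m n m≮ᵇn = ℕ.≮⇒≥ (λ m<n → contradiction (≡.trans (≡.sym (<ᵇ-true m<n)) m≮ᵇn) λ ())

  Bounded : ℕ → List ℕ → Set
  Bounded N = All (_< N)

  anyAbove : ℕ → List ℕ → Bool
  anyAbove a []      = false
  anyAbove a (c ∷ s) = (a <ᵇ c) ∨ anyAbove a s

  crossAscent : List ℕ → List ℕ → Bool
  crossAscent []      s = false
  crossAscent (a ∷ p) s = anyAbove a s ∨ crossAscent p s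

  endsWithAscent : List ℕ → Bool
  endsWithAscent (a ∷ b ∷ [])    = a <ᵇ b
  endsWithAscent (a ∷ b ∷ c ∷ r) = endsWithAscent (b ∷ c ∷ r)
  endsWithAscent _               = false

  startsWithAscent : List ℕ → Bool
  startsWithAscent (a ∷ b ∷ _) = a <ᵇ b
  startsWithAscent _           = false

  -- The site between p and s is active: inserting the maximum there keeps
  -- the word in S(132, 123̲).
  active : List ℕ → List ℕ → Bool
  active p s = not (crossAscent p s) ∧ not (endsWithAscent p)

  window123 : ℕ → List ℕ → Bool
  window123 a (b ∷ c ∷ _) = (a <ᵇ b) ∧ (b <ᵇ c)
  window123 a _           = false

  window312 : ℕ → List ℕ → ℕ
  window312 a (b ∷ c ∷ _) = if (b <ᵇ c) ∧ (c <ᵇ a) then 1 else 0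
  window312 a _           = 0

  containsCons123-∷ : ∀ a l → containsCons123 (a ∷ l) ≡ window123 a l ∨ containsCons123 l
  containsCons123-∷ a []          = ≡.refl
  containsCons123-∷ a (b ∷ [])    = ≡.refl
  containsCons123-∷ a (b ∷ c ∷ r) = ≡.refl

  occ312-∷ : ∀ a l → occ312 (a ∷ l) ≡ window312 a l + occ312 l
  occ312-∷ a []          = ≡.refl
  occ312-∷ a (b ∷ [])    = ≡.refl
  occ312-∷ a (b ∷ c ∷ r) = ≡.refl

  private
    open import Algebra.Bundles using (CommutativeMonoid)
    open import Algebra.Properties.CommutativeSemigroup
      (CommutativeMonoid.commutativeSemigroup Bool.∨-commutativeMonoid) using (interchange)

    -- N never plays the rôle of the 1 in a 132, and plays the 3 exactly with
    -- a letter a of p and a larger letter of s.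
    has21above-max : ∀ N s → Bounded N s → has21above N s ≡ false
    has21above-max N []      _            = ≡.refl
    has21above-max N (b ∷ s) (b<N ∷ s<N) rewrite <ᵇ-false {N} {b} (ℕ.<⇒≤ b<N) = has21above-max N s s<N

    any-skip : ∀ (f : ℕ → Bool) N q s → f N ≡ false → any f (q ++ N ∷ s) ≡ any f (q ++ s)
    any-skip f N []      s fN≡false rewrite fN≡false = ≡.refl
    any-skip f N (x ∷ q) s fN≡false = ≡.cong (f x ∨_) (any-skip f N q s fN≡false)

    any-between : ∀ a N s → Bounded N s → any (λ c → (a <ᵇ c) ∧ (c <ᵇ N)) s ≡ anyAbove a s
    any-between a N []      _ = ≡.refl
    any-between a N (c ∷ s) (c<N ∷ s<N) rewrite <ᵇ-true c<N | Bool.∧-identityʳ (a <ᵇ c) =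
      ≡.cong ((a <ᵇ c) ∨_) (any-between a N s s<N)

    has21above-insert : ∀ a N q s → a < N → Bounded N q → Bounded N s →
                        has21above a (q ++ N ∷ s) ≡ has21above a (q ++ s) ∨ anyAbove a s
    has21above-insert a N []      s a<N _ s<N rewrite <ᵇ-true a<N | any-between a N s s<N =
      Bool.∨-comm (anyAbove a s) (has21above a s)
    has21above-insert a N (b ∷ q) s a<N (b<N ∷ q<N) s<N = ≡.trans
      (≡.cong₂ (λ u v → ((a <ᵇ b) ∧ u) ∨ v)
               (any-skip (λ c → (a <ᵇ c) ∧ (c <ᵇ b)) N q s
                         (≡.trans (≡.cong ((a <ᵇ N) ∧_) (<ᵇ-false (ℕ.<⇒≤ b<N))) (Bool.∧-zeroʳ (a <ᵇ N))))
               (has21above-insert a N q s a<N q<N s<N))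
      (≡.sym (Bool.∨-assoc _ (has21above a (q ++ s)) (anyAbove a s)))

  contains132-insert : ∀ N p s → Bounded N (p ++ s) →
                       contains132 (p ++ N ∷ s) ≡ contains132 (p ++ s) ∨ crossAscent p s
  contains132-insert N []      s s<N rewrite has21above-max N s s<N = ≡.sym (Bool.∨-identityʳ (contains132 s))
  contains132-insert N (a ∷ p) s (a<N ∷ ps<N)
    rewrite has21above-insert a N p s a<N (All.++⁻ˡ p ps<N) (All.++⁻ʳ p ps<N) | contains132-insert N p s ps<N =
    interchange (has21above a (p ++ s)) (anyAbove a s) (contains132 (p ++ s)) (crossAscent p s)

  private
    window123-below-max : ∀ a N s → Bounded N s → window123 a (N ∷ s) ≡ false
    window123-below-max a N []      _         = ≡.refl
    window123-below-max a N (c ∷ s) (c<N ∷ _) rewrite <ᵇ-false {N} {c} (ℕ.<⇒≤ c<N) = Bool.∧-zeroʳ (a <ᵇ N)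

    window123-at-max : ∀ N s → Bounded N s → window123 N s ≡ false
    window123-at-max N []          _         = ≡.refl
    window123-at-max N (b ∷ [])    _         = ≡.refl
    window123-at-max N (b ∷ c ∷ s) (b<N ∷ _) rewrite <ᵇ-false {N} {b} (ℕ.<⇒≤ b<N) = ≡.refl

  containsCons123-insert : ∀ N p s → Bounded N (p ++ s) →
    containsCons123 (p ++ N ∷ s) ≡ (containsCons123 p ∨ endsWithAscent p) ∨ containsCons123 s
  containsCons123-insert N []      s s<N =
    ≡.trans (containsCons123-∷ N s) (≡.cong (_∨ containsCons123 s) (window123-at-max N s s<N))
  containsCons123-insert N (a ∷ p) s (a<N ∷ ps<N) = ≡.trans (containsCons123-∷ a (p ++ N ∷ s))
    (≡.trans (≡.cong (window123 a (p ++ N ∷ s) ∨_) (containsCons123-insert N p s ps<N)) (front p ps<N))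
    where
    front : ∀ p → Bounded N (p ++ s) →
            window123 a (p ++ N ∷ s) ∨ ((containsCons123 p ∨ endsWithAscent p) ∨ containsCons123 s)
            ≡ (containsCons123 (a ∷ p) ∨ endsWithAscent (a ∷ p)) ∨ containsCons123 s
    front []          s<N rewrite window123-below-max a N s s<N = ≡.refl
    front (b ∷ [])    (b<N ∷ _) rewrite <ᵇ-true b<N | Bool.∧-identityʳ (a <ᵇ b) = ≡.refl
    front (b ∷ c ∷ r) _ with window123 a (b ∷ c ∷ r)
    ... | true  = ≡.refl
    ... | false = ≡.refl

  private
    window123-++ : ∀ a p s → anyAbove a s ∨ crossAscent p s ≡ false → window123 a (p ++ s) ≡ window123 a p
    window123-++ a []          []          _ = ≡.refl
    window123-++ a []          (c ∷ [])    _ = ≡.refl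
    window123-++ a []          (c ∷ d ∷ r) none = ≡.cong (_∧ (c <ᵇ d))
      (Bool.∨-conicalˡ (a <ᵇ c) _ (Bool.∨-conicalˡ (anyAbove a (c ∷ d ∷ r)) _ none))
    window123-++ a (b ∷ [])    []          _ = ≡.refl
    window123-++ a (b ∷ [])    (c ∷ r)     none = ≡.trans
      (≡.cong ((a <ᵇ b) ∧_) (Bool.∨-conicalˡ (b <ᵇ c) _ (Bool.∨-conicalˡ ((b <ᵇ c) ∨ anyAbove b r) _
                              (Bool.∨-conicalʳ (anyAbove a (c ∷ r)) _ none))))
      (Bool.∧-zeroʳ (a <ᵇ b))
    window123-++ a (b ∷ c ∷ r) s _ = ≡.refl

  containsCons123-++ : ∀ p s → crossAscent p s ≡ false →
                       containsCons123 (p ++ s) ≡ containsCons123 p ∨ containsCons123 s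
  containsCons123-++ []      s _ = ≡.refl
  containsCons123-++ (a ∷ p) s none = begin
    containsCons123 (a ∷ p ++ s)
      ≡⟨ containsCons123-∷ a (p ++ s) ⟩
    window123 a (p ++ s) ∨ containsCons123 (p ++ s)
      ≡⟨ ≡.cong₂ _∨_ (window123-++ a p s none) (containsCons123-++ p s (Bool.∨-conicalʳ (anyAbove a s) _ none)) ⟩
    window123 a p ∨ (containsCons123 p ∨ containsCons123 s)
      ≡⟨ Bool.∨-assoc (window123 a p) (containsCons123 p) (containsCons123 s) ⟨
    (window123 a p ∨ containsCons123 p) ∨ containsCons123 s
      ≡⟨ ≡.cong (_∨ containsCons123 s) (containsCons123-∷ a p) ⟨
    containsCons123 (a ∷ p) ∨ containsCons123 s ∎
    where open ≡.≡-Reasoning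

  avoids-insert : ∀ N p s → Bounded N (p ++ s) → avoids (p ++ N ∷ s) ≡ avoids (p ++ s) ∧ active p s
  avoids-insert N p s ps<N rewrite contains132-insert N p s ps<N | containsCons123-insert N p s ps<N
    with crossAscent p s in cross
  ... | true  rewrite Bool.∨-zeroʳ (contains132 (p ++ s)) | Bool.∧-zeroʳ (avoids (p ++ s)) = ≡.refl
  ... | false rewrite containsCons123-++ p s cross =
    rearrange (contains132 (p ++ s)) (containsCons123 p) (endsWithAscent p) (containsCons123 s)
    where
    rearrange : ∀ x cp e cs → not (x ∨ false) ∧ not ((cp ∨ e) ∨ cs) ≡ (not x ∧ not (cp ∨ cs)) ∧ (not false ∧ not e)
    rearrange true  cp    e     cs = ≡.refl
    rearrange false true  e     cs = ≡.refl
    rearrange false false true  cs = ≡.sym (Bool.∧-zeroʳ (not cs))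
    rearrange false false false cs = ≡.sym (Bool.∧-identityʳ (not cs))

  Dominates : List ℕ → List ℕ → Set
  Dominates p s = All (λ a → All (_< a) s) p

  -- New occurrences of 312 from inserting at site j, given whether π starts
  -- with an ascent: only N in front of an ascent b < c creates one (N b c).
  frontGain : ℕ → Bool → ℕ
  frontGain zero    rises = if rises then 1 else 0
  frontGain (suc _) _     = 0

  private
    occ312-front : ∀ N s → Bounded N s → occ312 (N ∷ s) ≡ occ312 s + frontGain 0 (startsWithAscent s)
    occ312-front N []          _ = ≡.refl
    occ312-front N (b ∷ [])    _ = ≡.refl
    occ312-front N (b ∷ c ∷ r) (_ ∷ c<N ∷ _) rewrite <ᵇ-true c<N | Bool.∧-identityʳ (b <ᵇ c) = swap (b <ᵇ c)
      where swap : ∀ x → (if x then 1 else 0) + occ312 (b ∷ c ∷ r) ≡ occ312 (b ∷ c ∷ r) + (if x then 1 else 0)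
            swap x = ℕ.+-comm (if x then 1 else 0) _

    -- Behind a dominating nonempty prefix, N replaces a in every window
    -- N b c / a b c it could form.
    occ312-behind : ∀ N a p s → Bounded N (a ∷ p ++ s) → Dominates (a ∷ p) s →
                    occ312 (a ∷ p ++ N ∷ s) ≡ occ312 (a ∷ p ++ s)
    occ312-behind N a [] s (a<N ∷ s<N) (s<a ∷ _) = begin
      occ312 (a ∷ N ∷ s)                      ≡⟨ occ312-∷ a (N ∷ s) ⟩
      window312 a (N ∷ s) + occ312 (N ∷ s)    ≡⟨ ≡.cong₂ _+_ (no-window s s<N) (occ312-∷ N s) ⟩
      window312 N s + occ312 s                ≡⟨ ≡.cong (_+ occ312 s) (same-window s s<N s<a) ⟩
      window312 a s + occ312 s                ≡⟨ occ312-∷ a s ⟨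
      occ312 (a ∷ s)                          ∎
      where
      open ≡.≡-Reasoning
      no-window : ∀ s → Bounded N s → window312 a (N ∷ s) ≡ 0
      no-window []      _         = ≡.refl
      no-window (c ∷ r) (c<N ∷ _) rewrite <ᵇ-false {N} {c} (ℕ.<⇒≤ c<N) = ≡.refl
      same-window : ∀ s → Bounded N s → All (_< a) s → window312 N s ≡ window312 a s
      same-window []          _             _             = ≡.refl
      same-window (b ∷ [])    _             _             = ≡.refl
      same-window (b ∷ c ∷ r) (_ ∷ c<N ∷ _) (_ ∷ c<a ∷ _) rewrite <ᵇ-true c<N | <ᵇ-true c<a = ≡.refl
    occ312-behind N a (b ∷ p) s (a<N ∷ ps<N) (_ ∷ dominates) = begin
      occ312 (a ∷ b ∷ p ++ N ∷ s)                           ≡⟨ occ312-∷ a (b ∷ p ++ N ∷ s) ⟩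
      window312 a (b ∷ p ++ N ∷ s) + occ312 (b ∷ p ++ N ∷ s) ≡⟨ ≡.cong₂ _+_ (window p s ps<N dominates)
                                                                       (occ312-behind N b p s ps<N dominates) ⟩
      window312 a (b ∷ p ++ s) + occ312 (b ∷ p ++ s)         ≡⟨ occ312-∷ a (b ∷ p ++ s) ⟨
      occ312 (a ∷ b ∷ p ++ s)                               ∎
      where
      open ≡.≡-Reasoning
      window : ∀ p s → Bounded N (b ∷ p ++ s) → Dominates (b ∷ p) s →
               window312 a (b ∷ p ++ N ∷ s) ≡ window312 a (b ∷ p ++ s)
      window []      []      (b<N ∷ _) _ rewrite <ᵇ-false {N} {a} (ℕ.<⇒≤ a<N) | Bool.∧-zeroʳ (b <ᵇ N) = ≡.refl
      window []      (c ∷ r) (b<N ∷ _) ((c<b ∷ _) ∷ _)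
        rewrite <ᵇ-false {N} {a} (ℕ.<⇒≤ a<N) | Bool.∧-zeroʳ (b <ᵇ N) | <ᵇ-false {b} {c} (ℕ.<⇒≤ c<b) = ≡.refl
      window (c ∷ p) s _ _ = ≡.refl

  occ312-insert : ∀ N p s → Bounded N (p ++ s) → Dominates p s →
                  occ312 (p ++ N ∷ s) ≡ occ312 (p ++ s) + frontGain (length p) (startsWithAscent (p ++ s))
  occ312-insert N []      s s<N _ = occ312-front N s s<N
  occ312-insert N (a ∷ p) s ps<N dominates = ≡.trans (occ312-behind N a p s ps<N dominates) (≡.sym (ℕ.+-identityʳ _))

  startsWithAscentAfter : ℕ → Bool → Bool
  startsWithAscentAfter zero          _     = false
  startsWithAscentAfter (suc zero)    _     = true
  startsWithAscentAfter (suc (suc _)) rises = rises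

  startsWithAscent-insert : ∀ N p s → Bounded N (p ++ s) →
    startsWithAscent (p ++ N ∷ s) ≡ startsWithAscentAfter (length p) (startsWithAscent (p ++ s))
  startsWithAscent-insert N []          []      _         = ≡.refl
  startsWithAscent-insert N []          (c ∷ s) (c<N ∷ _) = <ᵇ-false (ℕ.<⇒≤ c<N)
  startsWithAscent-insert N (a ∷ [])    s       (a<N ∷ _) = <ᵇ-true a<N
  startsWithAscent-insert N (a ∷ b ∷ p) s       _         = ≡.refl

module ActiveSites where

  open InsertMax
  open import Data.Bool using (Bool; true; false; _∧_; _∨_; not)
  import Data.Bool.Properties as Bool
  open import Data.List using (List; []; _∷_; _++_; length; replicate; drop)
  open import Data.List.Properties using (++-assoc; ++-identityʳ)
  open import Data.List.Relation.Unary.All as All using (All; []; _∷_)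
  import Data.List.Relation.Unary.All.Properties as All
  open import Data.Nat as ℕ using (ℕ; zero; suc; _≤_; _<_; _<ᵇ_)
  import Data.Nat.Properties as ℕ
  open import Data.Unit using (⊤)
  open import Relation.Binary.PropositionalEquality as ≡ using (_≡_; _≢_)
  open import Relation.Nullary.Negation using (contradiction)

  -- siteBits pre l lists whether the sites |pre|, …, |pre| + |l| of pre ++ l
  -- are active.
  siteBits : List ℕ → List ℕ → List Bool
  siteBits pre []       = active pre [] ∷ []
  siteBits pre (y ∷ ys) = active pre (y ∷ ys) ∷ siteBits (pre ++ y ∷ []) ys

  -- Activity of the sites 1, …, n of π (site 0, the front, is always active).
  activeBits : List ℕ → List Bool
  activeBits []       = []
  activeBits (y ∷ ys) = siteBits (y ∷ []) ys

  isFront : ℕ → Bool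
  isFront zero    = true
  isFront (suc _) = false

  siteBits-all : ∀ π → siteBits [] π ≡ true ∷ activeBits π
  siteBits-all []       = ≡.refl
  siteBits-all (y ∷ ys) = ≡.refl

  LastAtLeast : List ℕ → ℕ → Set
  LastAtLeast []          c = ⊤
  LastAtLeast (x ∷ [])    c = c ≤ x
  LastAtLeast (x ∷ y ∷ r) c = LastAtLeast (y ∷ r) c

  private
    endsWithAscent-++ : ∀ q x y r → endsWithAscent (q ++ x ∷ y ∷ r) ≡ endsWithAscent (x ∷ y ∷ r)
    endsWithAscent-++ []          x y r = ≡.refl
    endsWithAscent-++ (a ∷ [])    x y r = ≡.refl
    endsWithAscent-++ (a ∷ b ∷ [])    x y r = ≡.refl
    endsWithAscent-++ (a ∷ b ∷ c ∷ q) x y r = endsWithAscent-++ (b ∷ c ∷ q) x y r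

    endsWithAscent-∷ʳ-small : ∀ pre c → LastAtLeast pre c → endsWithAscent (pre ++ c ∷ []) ≡ false
    endsWithAscent-∷ʳ-small []              c _   = ≡.refl
    endsWithAscent-∷ʳ-small (x ∷ [])        c c≤x = <ᵇ-false c≤x
    endsWithAscent-∷ʳ-small (x ∷ y ∷ [])    c c≤y = <ᵇ-false c≤y
    endsWithAscent-∷ʳ-small (x ∷ y ∷ z ∷ r) c c≤  = endsWithAscent-∷ʳ-small (y ∷ z ∷ r) c c≤

    endsWithAscent-∷ʳ-max : ∀ N p → p ≢ [] → Bounded N p → endsWithAscent (p ++ N ∷ []) ≡ true
    endsWithAscent-∷ʳ-max N []              p≢[] _                = contradiction ≡.refl p≢[]
    endsWithAscent-∷ʳ-max N (x ∷ [])        _    (x<N ∷ _)        = <ᵇ-true x<N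
    endsWithAscent-∷ʳ-max N (x ∷ y ∷ [])    _    (_ ∷ y<N ∷ _)    = <ᵇ-true y<N
    endsWithAscent-∷ʳ-max N (x ∷ y ∷ z ∷ r) _    (_ ∷ yzr<N)      = endsWithAscent-∷ʳ-max N (y ∷ z ∷ r) (λ ()) yzr<N

    endsWithAscent-skip-max : ∀ N pre c m → LastAtLeast pre c → c < N →
                              endsWithAscent (pre ++ N ∷ c ∷ m) ≡ endsWithAscent (pre ++ c ∷ m)
    endsWithAscent-skip-max N pre c []      last c<N = ≡.trans (endsWithAscent-++ pre N c [])
      (≡.trans (<ᵇ-false (ℕ.<⇒≤ c<N)) (≡.sym (endsWithAscent-∷ʳ-small pre c last)))
    endsWithAscent-skip-max N pre c (d ∷ m) last c<N = ≡.trans (endsWithAscent-++ pre N c (d ∷ m))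
      (≡.sym (endsWithAscent-++ pre c d m))

    anyAbove-max : ∀ N t → Bounded N t → anyAbove N t ≡ false
    anyAbove-max N []      _           = ≡.refl
    anyAbove-max N (c ∷ t) (c<N ∷ t<N) rewrite <ᵇ-false {N} {c} (ℕ.<⇒≤ c<N) = anyAbove-max N t t<N

    crossAscent-skip-max : ∀ N pre m t → Bounded N t → crossAscent (pre ++ N ∷ m) t ≡ crossAscent (pre ++ m) t
    crossAscent-skip-max N []        m t t<N rewrite anyAbove-max N t t<N = ≡.refl
    crossAscent-skip-max N (x ∷ pre) m t t<N = ≡.cong (anyAbove x t ∨_) (crossAscent-skip-max N pre m t t<N)

    crossAscent-[] : ∀ p → crossAscent p [] ≡ false
    crossAscent-[] []      = ≡.refl
    crossAscent-[] (x ∷ p) = crossAscent-[] p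

    siteBits-skip-max : ∀ N pre c m s → LastAtLeast pre c → c < N → Bounded N s →
                        siteBits (pre ++ N ∷ c ∷ m) s ≡ siteBits (pre ++ c ∷ m) s
    siteBits-skip-max N pre c m [] last c<N _
      rewrite crossAscent-[] (pre ++ N ∷ c ∷ m) | crossAscent-[] (pre ++ c ∷ m)
            | endsWithAscent-skip-max N pre c m last c<N = ≡.refl
    siteBits-skip-max N pre c m (y ∷ s) last c<N ys<N@(_ ∷ s<N) = ≡.cong₂ _∷_
      (≡.cong₂ (λ u v → not u ∧ not v) (crossAscent-skip-max N pre (c ∷ m) (y ∷ s) ys<N)
                                       (endsWithAscent-skip-max N pre c m last c<N))
      (≡.trans (≡.cong (λ z → siteBits z s) (++-assoc pre (N ∷ c ∷ m) (y ∷ [])))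
        (≡.trans (siteBits-skip-max N pre c (m ++ y ∷ []) s last c<N s<N)
                 (≡.cong (λ z → siteBits z s) (≡.sym (++-assoc pre (c ∷ m) (y ∷ []))))))

    anyAbove-max-in : ∀ x N q s → x < N → anyAbove x (q ++ N ∷ s) ≡ true
    anyAbove-max-in x N []      s x<N rewrite <ᵇ-true x<N = ≡.refl
    anyAbove-max-in x N (y ∷ q) s x<N rewrite anyAbove-max-in x N q s x<N = Bool.∨-zeroʳ (x <ᵇ y)

    inactive-before-max : ∀ N pre q s → pre ≢ [] → Bounded N pre → active pre (q ++ N ∷ s) ≡ false
    inactive-before-max N []        q s pre≢[] _ = contradiction ≡.refl pre≢[]
    inactive-before-max N (x ∷ pre) q s _ (x<N ∷ _) rewrite anyAbove-max-in x N q s x<N = ≡.refl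

    replicate-∷ʳ : ∀ n (x : Bool) l → replicate n x ++ x ∷ l ≡ x ∷ replicate n x ++ l
    replicate-∷ʳ zero    x l = ≡.refl
    replicate-∷ʳ (suc n) x l = ≡.cong (x ∷_) (replicate-∷ʳ n x l)

    siteBits-before-max : ∀ N pre q s → pre ≢ [] → Bounded N pre → Bounded N q →
      siteBits pre (q ++ N ∷ s) ≡ replicate (length q) false ++ false ∷ siteBits (pre ++ q ++ N ∷ []) s
    siteBits-before-max N pre []      s pre≢[] pre<N _ =
      ≡.cong (_∷ siteBits (pre ++ N ∷ []) s) (inactive-before-max N pre [] s pre≢[] pre<N)
    siteBits-before-max N pre (y ∷ q) s pre≢[] pre<N (y<N ∷ q<N) = ≡.cong₂ _∷_
      (inactive-before-max N pre (y ∷ q) s pre≢[] pre<N)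
      (≡.trans (siteBits-before-max N (pre ++ y ∷ []) q s (∷ʳ≢[] pre) (All.++⁺ pre<N (y<N ∷ [])) q<N)
               (≡.cong (λ z → replicate (length q) false ++ false ∷ siteBits z s) (++-assoc pre (y ∷ []) (q ++ N ∷ []))))
      where
      ∷ʳ≢[] : ∀ pre → pre ++ y ∷ [] ≢ []
      ∷ʳ≢[] []      ()
      ∷ʳ≢[] (_ ∷ _) ()

    drop-siteBits : ∀ pre q s → drop (length q) (siteBits pre (q ++ s)) ≡ siteBits (pre ++ q) s
    drop-siteBits pre []      s rewrite ++-identityʳ pre = ≡.refl
    drop-siteBits pre (y ∷ q) s = ≡.trans (drop-siteBits (pre ++ y ∷ []) q s)
                                          (≡.cong (λ z → siteBits z s) (++-assoc pre (y ∷ []) q))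

    last-from-noCross : ∀ p c t → crossAscent p (c ∷ t) ≡ false → LastAtLeast p c
    last-from-noCross []          c t _    = _
    last-from-noCross (x ∷ [])    c t none =
      <ᵇ-false⁻¹ x c (Bool.∨-conicalˡ (x <ᵇ c) _ (Bool.∨-conicalˡ (anyAbove x (c ∷ t)) _ none))
    last-from-noCross (x ∷ y ∷ r) c t none = last-from-noCross (y ∷ r) c t (Bool.∨-conicalʳ (anyAbove x (c ∷ t)) _ none)

    drop-suc : ∀ {A : Set} n (l : List A) → drop (suc n) l ≡ drop 1 (drop n l)
    drop-suc zero    l       = ≡.refl
    drop-suc (suc n) []      = ≡.refl
    drop-suc (suc n) (x ∷ l) = drop-suc n l

  active⇒noCross : ∀ p s → active p s ≡ true → crossAscent p s ≡ false
  active⇒noCross p s act with crossAscent p s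
  ... | false = ≡.refl

  activeBits-insert : ∀ N p s → Bounded N (p ++ s) → active p s ≡ true →
    activeBits (p ++ N ∷ s) ≡ replicate (length p) false ++ isFront (length p) ∷ drop (length p) (activeBits (p ++ s))
  activeBits-insert N []      []      _ _ = ≡.refl
  activeBits-insert N []      (c ∷ s) (c<N ∷ s<N) _ rewrite anyAbove-max N (c ∷ s) (c<N ∷ s<N) =
    ≡.cong (true ∷_) (siteBits-skip-max N [] c [] s _ c<N s<N)
  activeBits-insert N (a ∷ p) s ps<N act = begin
    siteBits (a ∷ []) (p ++ N ∷ s)
      ≡⟨ siteBits-before-max N (a ∷ []) p s (λ ()) (All.++⁻ˡ (a ∷ []) ap<N) (All.++⁻ʳ (a ∷ []) ap<N) ⟩
    replicate (length p) false ++ false ∷ siteBits (a ∷ p ++ N ∷ []) s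
      ≡⟨ ≡.cong (λ z → replicate (length p) false ++ false ∷ z) (behind s ps<N act) ⟩
    replicate (length p) false ++ false ∷ false ∷ rest s
      ≡⟨ replicate-∷ʳ (length p) false (false ∷ rest s) ⟩
    false ∷ replicate (length p) false ++ false ∷ rest s
      ≡⟨ ≡.cong (λ z → false ∷ replicate (length p) false ++ false ∷ z) (≡.sym dropped) ⟩
    false ∷ replicate (length p) false ++ false ∷ drop (suc (length p)) (siteBits (a ∷ []) (p ++ s)) ∎
    where
    open ≡.≡-Reasoning
    ap<N : Bounded N (a ∷ p)
    ap<N = All.++⁻ˡ (a ∷ p) ps<N
    rest : List ℕ → List Bool
    rest []       = []
    rest (c ∷ s′) = siteBits (a ∷ p ++ c ∷ []) s′
    drop-one : ∀ s → drop 1 (siteBits (a ∷ p) s) ≡ rest s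
    drop-one []       = ≡.refl
    drop-one (c ∷ s′) = ≡.refl
    dropped : drop (suc (length p)) (siteBits (a ∷ []) (p ++ s)) ≡ rest s
    dropped = ≡.trans (drop-suc (length p) (siteBits (a ∷ []) (p ++ s)))
                      (≡.trans (≡.cong (drop 1) (drop-siteBits (a ∷ []) p s)) (drop-one s))
    ends : endsWithAscent (a ∷ p ++ N ∷ []) ≡ true
    ends = endsWithAscent-∷ʳ-max N (a ∷ p) (λ ()) ap<N
    behind : ∀ s → Bounded N (a ∷ p ++ s) → active (a ∷ p) s ≡ true → siteBits (a ∷ p ++ N ∷ []) s ≡ false ∷ rest s
    behind []       _ _ rewrite ends = ≡.cong (_∷ []) (Bool.∧-zeroʳ (not (crossAscent (a ∷ p ++ N ∷ []) [])))
    behind (c ∷ s′) ps<N′ act′ rewrite ends = ≡.cong₂ _∷_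
      (Bool.∧-zeroʳ (not (crossAscent (a ∷ p ++ N ∷ []) (c ∷ s′))))
      (≡.trans (≡.cong (λ z → siteBits z s′) (++-assoc (a ∷ p) (N ∷ []) (c ∷ [])))
        (siteBits-skip-max N (a ∷ p) c [] s′ (last-from-noCross (a ∷ p) c s′ (active⇒noCross (a ∷ p) (c ∷ s′) act′))
                           c<N s′<N))
      where
      cs′<N = All.++⁻ʳ (a ∷ p) ps<N′
      c<N = All.head cs′<N
      s′<N = All.tail cs′<N

module Labels where

  open InsertMax
  open ActiveSites
  open ActiveSiteTree
  open GeneratingTree using (countᵇ)
  open import Data.Bool using (Bool; true; false; _∧_; _∨_; not)
  import Data.Bool.Properties as Bool
  open import Data.List using (List; []; _∷_; _++_; map; replicate; drop)
  import Data.List.Properties as List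
  open import Data.Nat as ℕ using (ℕ; zero; suc; _+_)
  import Data.Nat.Properties as ℕ
  open import Data.Product using (_×_; _,_; proj₁; proj₂)
  open import Function using (id; _∘_)
  open import Relation.Binary.PropositionalEquality as ≡ using (_≡_)

  shapeFromBits : List Bool → Bool → Shape
  shapeFromBits (true  ∷ _) _     = top
  shapeFromBits (false ∷ _) rises = shapeOf rises
  shapeFromBits []          rises = shapeOf rises

  labelFromBits : List Bool → Bool → Label
  labelFromBits bits rises = shapeFromBits bits rises , countᵇ id bits

  node : List ℕ → Label × ℕ
  node π = labelFromBits (activeBits π) (startsWithAscent π) , occ312 π

  -- The node of the child obtained by inserting at site j, as predicted by
  -- activeBits-insert, startsWithAscent-insert and occ312-insert.
  childAt : List Bool → Bool → ℕ → ℕ → Label × ℕ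
  childAt bits rises o j =
    labelFromBits (replicate j false ++ isFront j ∷ drop j bits) (startsWithAscentAfter j rises) , o + frontGain j rises

  positions : List Bool → List ℕ
  positions []           = []
  positions (true  ∷ bs) = 0 ∷ map suc (positions bs)
  positions (false ∷ bs) = map suc (positions bs)

  headBit : List Bool → Bool
  headBit []      = false
  headBit (b ∷ _) = b

  private
    count-skipped : ∀ j r → countᵇ id (replicate j false ++ false ∷ r) ≡ countᵇ id r
    count-skipped zero    r = ≡.refl
    count-skipped (suc j) r = count-skipped j r

    descending-positions : ∀ sh r →
      map (λ j → (sh , countᵇ id (drop (suc j) r)) , 0) (positions r) ≡ descending sh (countᵇ id r)
    descending-positions sh []          = ≡.refl
    descending-positions sh (true ∷ r)  = ≡.cong (((sh , countᵇ id r) , 0) ∷_)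
      (≡.trans (≡.sym (List.map-∘ (positions r))) (descending-positions sh r))
    descending-positions sh (false ∷ r) = ≡.trans (≡.sym (List.map-∘ (positions r))) (descending-positions sh r)

    insertions-shapeOf : ∀ rises h → insertions (shapeOf rises) h ≡ descending (shapeOf rises) h
    insertions-shapeOf true  h = ≡.refl
    insertions-shapeOf false h = ≡.refl

    -- A permutation whose site 1 is active does not start with an ascent.
    Consistent : List Bool → Bool → Set
    Consistent bits rises = headBit bits ≡ true → rises ≡ false

    insertions-positions : ∀ bits rises → Consistent bits rises →
      map (λ j → (shapeOf (startsWithAscentAfter (suc j) rises) , countᵇ id (drop (suc j) bits)) , 0) (positions bits)
      ≡ insertions (shapeFromBits bits rises) (countᵇ id bits)
    insertions-positions []           rises _ = ≡.sym (insertions-shapeOf rises 0)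
    insertions-positions (true  ∷ r)  rises consistent rewrite consistent ≡.refl =
      ≡.cong (((rise , countᵇ id r) , 0) ∷_) (≡.trans (≡.sym (List.map-∘ (positions r))) (descending-positions fall r))
    insertions-positions (false ∷ r)  rises _ = ≡.trans (≡.sym (List.map-∘ (positions r)))
      (≡.trans (descending-positions (shapeOf rises) r) (≡.sym (insertions-shapeOf rises (countᵇ id r))))

    frontGain-frontWeight : ∀ bits rises → Consistent bits rises → frontGain 0 rises ≡ frontWeight (shapeFromBits bits rises)
    frontGain-frontWeight []          true  _ = ≡.refl
    frontGain-frontWeight []          false _ = ≡.refl
    frontGain-frontWeight (true ∷ r)  rises consistent rewrite consistent ≡.refl = ≡.refl
    frontGain-frontWeight (false ∷ r) true  _ = ≡.refl
    frontGain-frontWeight (false ∷ r) false _ = ≡.refl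

  children-at-active-sites : ∀ bits rises o → (headBit bits ≡ true → rises ≡ false) →
    map (childAt bits rises o) (positions (true ∷ bits)) ≡ Full.expand (labelFromBits bits rises , o)
  children-at-active-sites bits rises o consistent = ≡.cong₂ _∷_
    (≡.cong (λ w → (top , suc (countᵇ id bits)) , o + w) (frontGain-frontWeight bits rises consistent))
    (begin
      map (childAt bits rises o) (map suc (positions bits))
        ≡⟨ List.map-∘ (positions bits) ⟨
      map (childAt bits rises o ∘ suc) (positions bits)
        ≡⟨ List.map-cong (λ j → ≡.cong (λ c → (shapeOf (startsWithAscentAfter (suc j) rises) , c) , o + 0)
                                        (count-skipped j (drop (suc j) bits))) (positions bits) ⟩
      map (λ j → (shapeOf (startsWithAscentAfter (suc j) rises) , countᵇ id (drop (suc j) bits)) , o + 0) (positions bits)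
        ≡⟨ List.map-∘ (positions bits) ⟩
      map (λ cw → proj₁ cw , o + proj₂ cw)
          (map (λ j → (shapeOf (startsWithAscentAfter (suc j) rises) , countᵇ id (drop (suc j) bits)) , 0) (positions bits))
        ≡⟨ ≡.cong (map (λ cw → proj₁ cw , o + proj₂ cw)) (insertions-positions bits rises consistent) ⟩
      map (λ cw → proj₁ cw , o + proj₂ cw) (insertions (shapeFromBits bits rises) (countᵇ id bits)) ∎)
    where open ≡.≡-Reasoning

  -- If site 1 of π is active, π₁ is its maximum, so π does not start with an ascent.
  site₁-active⇒falls : ∀ π → headBit (activeBits π) ≡ true → startsWithAscent π ≡ false
  site₁-active⇒falls []          ()
  site₁-active⇒falls (y ∷ [])    _      = ≡.refl
  site₁-active⇒falls (y ∷ c ∷ r) active₁ =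
    Bool.∨-conicalˡ (y ℕ.<ᵇ c) _ (Bool.∨-conicalˡ (anyAbove y (c ∷ r)) _ (no-cross (anyAbove y (c ∷ r) ∨ false) active₁))
    where
    no-cross : ∀ z → not z ∧ not false ≡ true → z ≡ false
    no-cross false _ = ≡.refl

module Avoiders where

  open SeriesRing
  open InsertMax
  open ActiveSites
  open Labels
  open ActiveSiteTree
  open GeneratingTree using (countᵇ; length-filterᵇ; countᵇ-filterᵇ; countᵇ-map)
  open import Data.Bool using (Bool; true; false; if_then_else_; _∧_; T?)
  import Data.Bool.Properties as Bool
  open import Data.Integer using (+_)
  open import Data.List using (List; []; _∷_; _++_; map; concatMap; length; filterᵇ)
  import Data.List.Properties as List
  open import Data.List.Relation.Unary.All as All using (All; []; _∷_)
  import Data.List.Relation.Unary.All.Properties as All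
  open import Data.List.Relation.Unary.Unique.Propositional using (Unique; []; _∷_)
  open import Data.Nat as ℕ using (ℕ; zero; suc; _≤_; _<_; _≡ᵇ_)
  import Data.Nat.Properties as ℕ
  open import Data.Product using (_×_; _,_; proj₁; proj₂)
  open import Function using (_∘_)
  open import Relation.Binary.PropositionalEquality as ≡ using (_≡_; _≢_)

  private
    variable
      A B : Set

    filterᵇ-map : ∀ (p : B → Bool) (f : A → B) xs → filterᵇ p (map f xs) ≡ map f (filterᵇ (p ∘ f) xs)
    filterᵇ-map p f []       = ≡.refl
    filterᵇ-map p f (x ∷ xs) with p (f x)
    ... | true  = ≡.cong (f x ∷_) (filterᵇ-map p f xs)
    ... | false = filterᵇ-map p f xs

    filterᵇ-cong-local : ∀ {p q : A → Bool} {xs} → All (λ x → p x ≡ q x) xs → filterᵇ p xs ≡ filterᵇ q xs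
    filterᵇ-cong-local                 []                 = ≡.refl
    filterᵇ-cong-local {p = p} {q} {x ∷ _} (px≡qx ∷ p≗q) with p x | q x | px≡qx
    ... | true  | .true  | ≡.refl = ≡.cong (x ∷_) (filterᵇ-cong-local p≗q)
    ... | false | .false | ≡.refl = filterᵇ-cong-local p≗q

    filterᵇ-∷ : ∀ (p : A → Bool) x xs → filterᵇ p (x ∷ xs) ≡ (if p x then x ∷ filterᵇ p xs else filterᵇ p xs)
    filterᵇ-∷ p x xs with p x
    ... | true  = ≡.refl
    ... | false = ≡.refl

    filterᵇ-false : ∀ (xs : List A) → filterᵇ (λ _ → false) xs ≡ []
    filterᵇ-false []       = ≡.refl
    filterᵇ-false (x ∷ xs) = filterᵇ-false xs

    All-filterᵇ : ∀ {Q : A → Set} (p : A → Bool) {xs} → All Q xs → All (λ x → Q x × p x ≡ true) (filterᵇ p xs)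
    All-filterᵇ p {[]}     []       = []
    All-filterᵇ p {x ∷ xs} (q ∷ qs) with p x in px
    ... | true  = (q , px) ∷ All-filterᵇ p qs
    ... | false = All-filterᵇ p qs

  prepend : ℕ → List ℕ × List ℕ → List ℕ × List ℕ
  prepend y ps = y ∷ proj₁ ps , proj₂ ps

  splits : List ℕ → List (List ℕ × List ℕ)
  splits []       = ([] , []) ∷ []
  splits (y ∷ ys) = ([] , y ∷ ys) ∷ map (prepend y) (splits ys)

  insertAt : ℕ → List ℕ × List ℕ → List ℕ
  insertAt N ps = proj₁ ps ++ N ∷ proj₂ ps

  activeSplit : List ℕ × List ℕ → Bool
  activeSplit ps = active (proj₁ ps) (proj₂ ps)

  insertEverywhere-splits : ∀ N π → insertEverywhere N π ≡ map (insertAt N) (splits π)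
  insertEverywhere-splits N []       = ≡.refl
  insertEverywhere-splits N (y ∷ ys) = ≡.cong ((N ∷ y ∷ ys) ∷_)
    (≡.trans (≡.cong (map (y ∷_)) (insertEverywhere-splits N ys))
             (≡.trans (≡.sym (List.map-∘ (splits ys))) (List.map-∘ (splits ys))))

  splits-++ : ∀ π → All (λ ps → proj₁ ps ++ proj₂ ps ≡ π) (splits π)
  splits-++ []       = ≡.refl ∷ []
  splits-++ (y ∷ ys) = ≡.refl ∷ All.map⁺ (All.map (≡.cong (y ∷_)) (splits-++ ys))

  splits-activity : ∀ pre π → map (λ ps → active (pre ++ proj₁ ps) (proj₂ ps)) (splits π) ≡ siteBits pre π
  splits-activity pre []       rewrite List.++-identityʳ pre = ≡.refl
  splits-activity pre (y ∷ ys) rewrite List.++-identityʳ pre = ≡.cong (active pre (y ∷ ys) ∷_)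
    (≡.trans (≡.sym (List.map-∘ (splits ys)))
      (≡.trans (List.map-cong (λ ps → ≡.cong (λ z → active z (proj₂ ps)) (≡.sym (List.++-assoc pre (y ∷ []) (proj₁ ps))))
                              (splits ys))
               (splits-activity (pre ++ y ∷ []) ys)))

  positions-splits : ∀ (q : List ℕ × List ℕ → Bool) π →
                     map (length ∘ proj₁) (filterᵇ q (splits π)) ≡ positions (map q (splits π))
  positions-behind : ∀ (q : List ℕ × List ℕ → Bool) y ys →
                     map (length ∘ proj₁) (filterᵇ q (map (prepend y) (splits ys)))
                     ≡ map suc (positions (map q (map (prepend y) (splits ys))))

  positions-splits q []       with q ([] , [])
  ... | true  = ≡.refl
  ... | false = ≡.refl
  positions-splits q (y ∷ ys) with q ([] , y ∷ ys)
  ... | true  = ≡.cong (0 ∷_) (positions-behind q y ys)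
  ... | false = positions-behind q y ys

  positions-behind q y ys = begin
    map (length ∘ proj₁) (filterᵇ q (map (prepend y) (splits ys)))
      ≡⟨ ≡.cong (map (length ∘ proj₁)) (filterᵇ-map q (prepend y) (splits ys)) ⟩
    map (length ∘ proj₁) (map (prepend y) (filterᵇ (q ∘ prepend y) (splits ys)))
      ≡⟨ List.map-∘ (filterᵇ (q ∘ prepend y) (splits ys)) ⟨
    map (suc ∘ length ∘ proj₁) (filterᵇ (q ∘ prepend y) (splits ys))
      ≡⟨ List.map-∘ (filterᵇ (q ∘ prepend y) (splits ys)) ⟩
    map suc (map (length ∘ proj₁) (filterᵇ (q ∘ prepend y) (splits ys)))
      ≡⟨ ≡.cong (map suc) (positions-splits (q ∘ prepend y) ys) ⟩
    map suc (positions (map (q ∘ prepend y) (splits ys)))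
      ≡⟨ ≡.cong (map suc ∘ positions) (List.map-∘ (splits ys)) ⟩
    map suc (positions (map q (map (prepend y) (splits ys)))) ∎
    where open ≡.≡-Reasoning

  node-insert : ∀ N p s → Bounded N (p ++ s) → active p s ≡ true → Dominates p s →
    node (p ++ N ∷ s) ≡ childAt (activeBits (p ++ s)) (startsWithAscent (p ++ s)) (occ312 (p ++ s)) (length p)
  node-insert N p s ps<N act dom = ≡.cong₂ _,_
    (≡.cong₂ labelFromBits (activeBits-insert N p s ps<N act) (startsWithAscent-insert N p s ps<N))
    (occ312-insert N p s ps<N dom)

  dominates : ∀ p s → Unique (p ++ s) → crossAscent p s ≡ false → Dominates p s
  dominates []      s _                 _    = []
  dominates (a ∷ p) s (a∉ps ∷ distinct) none =
    All.map below (All.zip (at-most a s (Bool.∨-conicalˡ (anyAbove a s) _ none) , All.++⁻ʳ p a∉ps))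
    ∷ dominates p s distinct (Bool.∨-conicalʳ (anyAbove a s) _ none)
    where
    at-most : ∀ a s → anyAbove a s ≡ false → All (_≤ a) s
    at-most a []      _    = []
    at-most a (c ∷ s) none = <ᵇ-false⁻¹ a c (Bool.∨-conicalˡ (a ℕ.<ᵇ c) _ none)
                             ∷ at-most a s (Bool.∨-conicalʳ (a ℕ.<ᵇ c) _ none)
    below : ∀ {c} → c ≤ a × a ≢ c → c < a
    below (c≤a , a≢c) = ℕ.≤∧≢⇒< c≤a (a≢c ∘ ≡.sym)

  insertion-children : ∀ N π → Bounded N π → Unique π →
    map node (filterᵇ avoids (insertEverywhere N π)) ≡ (if avoids π then Full.expand (node π) else [])
  insertion-children N π π<N distinct = ≡.trans keep-active (by-avoids (avoids π))
    where
    open ≡.≡-Reasoning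
    child : ℕ → Label × ℕ
    child = childAt (activeBits π) (startsWithAscent π) (occ312 π)

    insert-at : ∀ ps → proj₁ ps ++ proj₂ ps ≡ π → avoids (insertAt N ps) ≡ avoids π ∧ activeSplit ps
    insert-at (p , s) ≡.refl = avoids-insert N p s π<N

    keep-active : map node (filterᵇ avoids (insertEverywhere N π))
                  ≡ map node (map (insertAt N) (filterᵇ (λ ps → avoids π ∧ activeSplit ps) (splits π)))
    keep-active = begin
      map node (filterᵇ avoids (insertEverywhere N π))
        ≡⟨ ≡.cong (map node ∘ filterᵇ avoids) (insertEverywhere-splits N π) ⟩
      map node (filterᵇ avoids (map (insertAt N) (splits π)))
        ≡⟨ ≡.cong (map node) (filterᵇ-map avoids (insertAt N) (splits π)) ⟩
      map node (map (insertAt N) (filterᵇ (avoids ∘ insertAt N) (splits π)))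
        ≡⟨ ≡.cong (map node ∘ map (insertAt N)) (filterᵇ-cong-local (All.map (λ {ps} → insert-at ps) (splits-++ π))) ⟩
      map node (map (insertAt N) (filterᵇ (λ ps → avoids π ∧ activeSplit ps) (splits π))) ∎

    node-at : ∀ ps → proj₁ ps ++ proj₂ ps ≡ π × activeSplit ps ≡ true → node (insertAt N ps) ≡ child (length (proj₁ ps))
    node-at (p , s) (≡.refl , act) = node-insert N p s π<N act (dominates p s distinct (active⇒noCross p s act))

    by-avoids : ∀ b → map node (map (insertAt N) (filterᵇ (λ ps → b ∧ activeSplit ps) (splits π)))
                      ≡ (if b then Full.expand (node π) else [])
    by-avoids false = ≡.cong (map node ∘ map (insertAt N)) (filterᵇ-false (splits π))
    by-avoids true  = begin
      map node (map (insertAt N) (filterᵇ activeSplit (splits π)))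
        ≡⟨ List.map-∘ (filterᵇ activeSplit (splits π)) ⟨
      map (node ∘ insertAt N) (filterᵇ activeSplit (splits π))
        ≡⟨ List.map-cong-local (All.map (λ {ps} → node-at ps) (All-filterᵇ activeSplit (splits-++ π))) ⟩
      map (child ∘ length ∘ proj₁) (filterᵇ activeSplit (splits π))
        ≡⟨ List.map-∘ (filterᵇ activeSplit (splits π)) ⟩
      map child (map (length ∘ proj₁) (filterᵇ activeSplit (splits π)))
        ≡⟨ ≡.cong (map child) (positions-splits activeSplit π) ⟩
      map child (positions (map activeSplit (splits π)))
        ≡⟨ ≡.cong (map child ∘ positions) (≡.trans (splits-activity [] π) (siteBits-all π)) ⟩
      map child (positions (true ∷ activeBits π))
        ≡⟨ children-at-active-sites (activeBits π) (startsWithAscent π) (occ312 π) (site₁-active⇒falls π) ⟩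
      Full.expand (node π) ∎

  Valid : ℕ → List ℕ → Set
  Valid n π = Bounded (suc n) π × Unique π

  private
    insertEverywhere-All : ∀ {Q : ℕ → Set} N ys → Q N → All Q ys → All (All Q) (insertEverywhere N ys)
    insertEverywhere-All N []       qN []        = (qN ∷ []) ∷ []
    insertEverywhere-All N (y ∷ ys) qN (qy ∷ qs) =
      (qN ∷ qy ∷ qs) ∷ All.map⁺ (All.map (qy ∷_) (insertEverywhere-All N ys qN qs))

    insertEverywhere-valid : ∀ N π → Bounded N π → Unique π →
                             All (λ σ → Bounded (suc N) σ × Unique σ) (insertEverywhere N π)
    insertEverywhere-valid N []       _            _ = ((ℕ.n<1+n N ∷ []) , ([] ∷ [])) ∷ []
    insertEverywhere-valid N (y ∷ ys) yys<N@(y<N ∷ ys<N) (y∉ys ∷ distinct) =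
      ((ℕ.n<1+n N ∷ All.map ℕ.m<n⇒m<1+n yys<N) ,
       (All.map (λ x<N N≡x → ℕ.<-irrefl (≡.sym N≡x) x<N) yys<N ∷ y∉ys ∷ distinct))
      ∷ All.map⁺ (All.map extend (All.zip (insertEverywhere-valid N ys ys<N distinct ,
                                           insertEverywhere-All N ys (λ y≡N → ℕ.<-irrefl y≡N y<N) y∉ys)))
      where
      extend : ∀ {σ} → (Bounded (suc N) σ × Unique σ) × All (y ≢_) σ → Bounded (suc N) (y ∷ σ) × Unique (y ∷ σ)
      extend ((σ<1+N , distinct-σ) , y∉σ) = (ℕ.m<n⇒m<1+n y<N ∷ σ<1+N) , (y∉σ ∷ distinct-σ)

  perms-valid : ∀ n → All (Valid n) (perms n)
  perms-valid zero    = ([] , []) ∷ []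
  perms-valid (suc n) = All.concat⁺ (All.map⁺ (All.map
    (λ {π} valid → insertEverywhere-valid (suc n) π (proj₁ valid) (proj₂ valid)) (perms-valid n)))

  private
    level-step : ∀ n L → All (Valid n) L →
      map node (filterᵇ avoids (concatMap (insertEverywhere (suc n)) L)) ≡ concatMap Full.expand (map node (filterᵇ avoids L))
    level-step n []      []                      = ≡.refl
    level-step n (π ∷ L) ((π<1+n , distinct) ∷ valid) = begin
      map node (filterᵇ avoids (insertEverywhere (suc n) π ++ concatMap (insertEverywhere (suc n)) L))
        ≡⟨ ≡.cong (map node) (List.filter-++ (T? ∘ avoids) (insertEverywhere (suc n) π) _) ⟩
      map node (filterᵇ avoids (insertEverywhere (suc n) π) ++ filterᵇ avoids (concatMap (insertEverywhere (suc n)) L))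
        ≡⟨ List.map-++ node (filterᵇ avoids (insertEverywhere (suc n) π)) _ ⟩
      map node (filterᵇ avoids (insertEverywhere (suc n) π)) ++ map node (filterᵇ avoids (concatMap (insertEverywhere (suc n)) L))
        ≡⟨ ≡.cong₂ _++_ (insertion-children (suc n) π π<1+n distinct) (level-step n L valid) ⟩
      (if avoids π then Full.expand (node π) else []) ++ concatMap Full.expand (map node (filterᵇ avoids L))
        ≡⟨ by-avoids (avoids π) ⟩
      concatMap Full.expand (map node (if avoids π then π ∷ filterᵇ avoids L else filterᵇ avoids L))
        ≡⟨ ≡.cong (concatMap Full.expand ∘ map node) (filterᵇ-∷ avoids π L) ⟨
      concatMap Full.expand (map node (filterᵇ avoids (π ∷ L))) ∎
      where
      open ≡.≡-Reasoning
      by-avoids : ∀ b → (if b then Full.expand (node π) else []) ++ concatMap Full.expand (map node (filterᵇ avoids L))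
                        ≡ concatMap Full.expand (map node (if b then π ∷ filterᵇ avoids L else filterᵇ avoids L))
      by-avoids true  = ≡.refl
      by-avoids false = ≡.refl

  avoiders-level : ∀ n → map node (filterᵇ avoids (perms n)) ≡ Full.level root n
  avoiders-level zero    = ≡.refl
  avoiders-level (suc n) = ≡.trans (level-step n (perms n) (perms-valid n)) (≡.cong (concatMap Full.expand) (avoiders-level n))

  F≋F₀ : F ≋ F₀
  F≋F₀ n k = ≡.cong +_ (begin
    length (filterᵇ (λ π → avoids π ∧ (occ312 π ≡ᵇ k)) (perms n))
      ≡⟨ length-filterᵇ _ (perms n) ⟩
    countᵇ (λ π → avoids π ∧ (occ312 π ≡ᵇ k)) (perms n)
      ≡⟨ countᵇ-filterᵇ (λ π → occ312 π ≡ᵇ k) avoids (perms n) ⟨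
    countᵇ (λ π → occ312 π ≡ᵇ k) (filterᵇ avoids (perms n))
      ≡⟨ countᵇ-map (Full.hasLabel&Weight everything k) node (filterᵇ avoids (perms n)) ⟨
    countᵇ (Full.hasLabel&Weight everything k) (map node (filterᵇ avoids (perms n)))
      ≡⟨ ≡.cong (countᵇ (Full.hasLabel&Weight everything k)) (avoiders-level n) ⟩
    countᵇ (Full.hasLabel&Weight everything k) (Full.level root n) ∎)
    where open ≡.≡-Reasoning

open SeriesRing using (seriesRing)
open ClosedForm using (closed-form)
open ActiveSiteTree using (F₀; V₀; F₀-equation; V₀-equation)
open Avoiders using (F≋F₀)

mainTheorem17 : Σ Series IsG × ((G : Series) → IsG G → F ⊛ Den G ≋ Num G)
mainTheorem17 = root , λ G isG → S.trans (S.*-congʳ {Den G} F≋F₀) (formula G isG)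
  where
  module S = CommutativeRing seriesRing
  open Σ (closed-form F₀ V₀ F₀-equation V₀-equation) renaming (proj₁ to root; proj₂ to formula)
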